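{- Let $A$ be an unramified discrete valuation ring and let $B$ be a henselian valuation ring extending $A$ (i.e. $A\subseteq B$ and the maximal ideal of $B$ intersects $A$ in the maximal ideal of $A$). Let $f\in A[X]$ be an Eisenstein polynomial of degree $e$ and let $d(e)=e(1+v_p(e))$, where $v_p$ is the $p$-adic valuation on $\mathbb{Q}$. Then $f$ has a zero in $B$ if and only if the reduction of $f$ modulo $p^{d(e)}$ has a zero in $B/p^{d(e)}B$.
   Context: Fix a prime $p$. An unramified discrete valuation ring is a discrete valuation ring of characteristic $0$ with residue characteristic $p$ in which $p$ is a uniformizer. A polynomial $f\in A[X]$ over a discrete valuation ring $A$ is Eisenstein if it is monic, all its non-leading coefficients lie in the maximal ideal, and its constant coefficient is a uniformizer. -}

module Defs where

open import Level using (Level; _⊔_)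
open import Data.Nat as ℕ using (ℕ; zero; suc)
open import Data.Nat.Divisibility as ℕD using (_∣?_)
open import Data.List using (List; []; _∷_; map; length)
open import Data.Product using (Σ; ∃; _×_; _,_)
open import Data.Sum using (_⊎_)
open import Relation.Nullary using (¬_; yes; no)
open import Relation.Binary.PropositionalEquality using (_≡_)
open import Algebra.Bundles using (CommutativeRing)
open import Algebra.Morphism.Structures using (module RingMorphisms)

-- p-adic valuation on positive naturals (fuel = n suffices)

vpAux : ℕ → ℕ → ℕ → ℕ
vpAux zero    _ _ = 0
vpAux (suc q) zero    _ = 0
vpAux (suc q) (suc f) zero = 0
vpAux (suc q) (suc f) (suc m) with suc q ∣? suc m
... | yes _ = suc (vpAux (suc q) f (suc m ℕ./ suc q))
... | no  _ = 0

-- vp p n = exponent of p in n  (meaningful for p prime and n ≥ 1)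
vp : ℕ → ℕ → ℕ
vp p n = vpAux p n n

dBound : ℕ → ℕ → ℕ
dBound p e = e ℕ.* (1 ℕ.+ vp p e)

module _ {c ℓ : Level} (R : CommutativeRing c ℓ) where
  open CommutativeRing R

  natMul : ℕ → Carrier → Carrier
  natMul zero    x = 0#
  natMul (suc n) x = x + natMul n x

  _^ᴿ_ : Carrier → ℕ → Carrier
  x ^ᴿ zero  = 1#
  x ^ᴿ suc n = x * (x ^ᴿ n)

  Unit : Carrier → Set (c ⊔ ℓ)
  Unit x = ∃ λ y → x * y ≈ 1#

  Divides : Carrier → Carrier → Set (c ⊔ ℓ)
  Divides x y = ∃ λ z → y ≈ x * z

  IsDomain : Set (c ⊔ ℓ)
  IsDomain = (¬ (1# ≈ 0#)) × (∀ x y → x * y ≈ 0# → (x ≈ 0#) ⊎ (y ≈ 0#))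

  IsValuationRing : Set (c ⊔ ℓ)
  IsValuationRing = IsDomain × (∀ x y → Divides x y ⊎ Divides y x)

  -- In a local ring (e.g. a valuation ring) the maximal ideal is the set
  -- of non-units.
  InMaxIdeal : Carrier → Set (c ⊔ ℓ)
  InMaxIdeal x = ¬ Unit x

  IsUniformizer : Carrier → Set (c ⊔ ℓ)
  IsUniformizer π = InMaxIdeal π × (∀ x → InMaxIdeal x → Divides π x)

  IsDVR : Set (c ⊔ ℓ)
  IsDVR = IsValuationRing ×
          (∃ λ π → (¬ (π ≈ 0#)) × InMaxIdeal π ×
             (∀ x → ¬ (x ≈ 0#) → ∃ λ n → ∃ λ u → Unit u × (x ≈ u * (π ^ᴿ n))))

  HasCharZero : Set ℓ
  HasCharZero = ∀ n → ¬ (natMul (suc n) 1# ≈ 0#)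

  IsUnramifiedDVR : ℕ → Set (c ⊔ ℓ)
  IsUnramifiedDVR p = IsDVR × HasCharZero × InMaxIdeal (natMul p 1#)
                      × IsUniformizer (natMul p 1#)

  -- Polynomials: coefficient lists, constant coefficient first.

  Poly : Set c
  Poly = List Carrier

  coeff : Poly → ℕ → Carrier
  coeff []       _       = 0#
  coeff (a ∷ as) zero    = a
  coeff (a ∷ as) (suc i) = coeff as i

  eval : Poly → Carrier → Carrier
  eval []       x = 0#
  eval (a ∷ as) x = a + x * eval as x

  derivAux : ℕ → Poly → Poly
  derivAux k []       = []
  derivAux k (a ∷ as) = natMul k a ∷ derivAux (suc k) as

  deriv : Poly → Poly
  deriv []       = []
  deriv (a ∷ as) = derivAux 1 as

  IsMonicOfDegree : Poly → ℕ → Set ℓ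
  IsMonicOfDegree f n = (length f ≡ suc n) × (coeff f n ≈ 1#)

  IsEisenstein : Poly → ℕ → Set (c ⊔ ℓ)
  IsEisenstein f e = IsMonicOfDegree f e
                   × (∀ i → i ℕ.< e → InMaxIdeal (coeff f i))
                   × IsUniformizer (coeff f 0)

  IsHenselian : Set (c ⊔ ℓ)
  IsHenselian = ∀ (f : Poly) (n : ℕ) → IsMonicOfDegree f n → ∀ a →
                InMaxIdeal (eval f a) → Unit (eval (deriv f) a) →
                ∃ λ b → (eval f b ≈ 0#) × InMaxIdeal (b + - a)

module _ {a ℓa b ℓb : Level} (A : CommutativeRing a ℓa) (B : CommutativeRing b ℓb) where
  private
    module A = CommutativeRing A
    module B = CommutativeRing B

  IsExtension : (A.Carrier → B.Carrier) → Set (a ⊔ ℓa ⊔ b ⊔ ℓb)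
  IsExtension φ =
    RingMorphisms.IsRingMonomorphism A.rawRing B.rawRing φ ×
    (∀ x → (InMaxIdeal A x → InMaxIdeal B (φ x)) × (InMaxIdeal B (φ x) → InMaxIdeal A x))

-- Suppose f(x) ≡ 0 mod pᵈ⁽ᵉ⁾ in B.  The Eisenstein shape of f forces xᵉ = p·(unit), so in
-- B the element p has x-adic order e, and an element of A of p-adic valuation n has order e n.
-- The terms (i + 1) aᵢ₊₁ xⁱ of f′(x) therefore have orders e·vₚ((i + 1) aᵢ₊₁) + i, pairwise
-- distinct modulo e, and the term e xᵉ⁻¹ has order e vₚ(e) + e − 1; so f′(x) has order
-- K ≤ e vₚ(e) + e − 1, whence 2K < e d(e), the order of f(x).  Thus f(x) = f′(x)² c with c in
-- the maximal ideal, and Newton's lemma, valid in any henselian valuation ring, gives a root.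

module Submission where

open import Defs
open import Level using (Level)
open import Data.Nat using (ℕ)
open import Data.Nat.Primality using (Prime)
open import Data.List using (map)
open import Data.Product using (∃; _×_)
open import Function.Bundles using (_⇔_; mk⇔)
open import Algebra.Bundles using (CommutativeRing)

open import Data.Nat as ℕ using (zero; suc)
import Data.Nat.Properties as ℕ
open import Data.Integer as ℤ using (ℤ; +_; -[1+_])
import Data.Integer.Properties as ℤ
open import Data.Sign as Sign using (Sign)
open import Data.List using (List; []; _∷_; length; _++_)
open import Data.List.Properties using (length-map)
open import Data.Product using (_,_; proj₁; proj₂)
open import Data.Sum using (_⊎_; inj₁; inj₂)
open import Relation.Binary.Definitions using (Tri; tri<; tri≈; tri>)
open import Data.Empty using (⊥-elim)
open import Data.Maybe using (Maybe; just; nothing)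
open import Relation.Nullary using (¬_; yes; no)
open import Relation.Binary.PropositionalEquality as ≡ using (_≡_)
import Relation.Binary.Reasoning.Setoid as SetoidReasoning

module NatCast {c ℓ} (R : CommutativeRing c ℓ) where
  open CommutativeRing R
  open SetoidReasoning setoid

  fromℕ : ℕ → Carrier
  fromℕ n = natMul R n 1#

  fromℕ-+ : ∀ m n → fromℕ (m ℕ.+ n) ≈ fromℕ m + fromℕ n
  fromℕ-+ zero    n = sym (+-identityˡ _)
  fromℕ-+ (suc m) n = trans (+-congˡ (fromℕ-+ m n)) (sym (+-assoc _ _ _))

  natMul≈fromℕ* : ∀ n x → natMul R n x ≈ fromℕ n * x
  natMul≈fromℕ* zero    x = sym (zeroˡ x)
  natMul≈fromℕ* (suc n) x = begin
    x + natMul R n x      ≈⟨ +-cong (sym (*-identityˡ x)) (natMul≈fromℕ* n x) ⟩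
    1# * x + fromℕ n * x  ≈⟨ distribʳ x 1# (fromℕ n) ⟨
    fromℕ (suc n) * x     ∎

  fromℕ-* : ∀ m n → fromℕ (m ℕ.* n) ≈ fromℕ m * fromℕ n
  fromℕ-* zero    n = sym (zeroˡ _)
  fromℕ-* (suc m) n = begin
    fromℕ (n ℕ.+ m ℕ.* n)            ≈⟨ fromℕ-+ n (m ℕ.* n) ⟩
    fromℕ n + fromℕ (m ℕ.* n)        ≈⟨ +-congˡ (fromℕ-* m n) ⟩
    fromℕ n + fromℕ m * fromℕ n      ≈⟨ +-congˡ (natMul≈fromℕ* m (fromℕ n)) ⟨
    natMul R (suc m) (fromℕ n)       ≈⟨ natMul≈fromℕ* (suc m) (fromℕ n) ⟩
    fromℕ (suc m) * fromℕ n          ∎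

-- Algebra.Solver.Ring needs a coefficient ring with decidable equality; ℤ,
-- mapped to R canonically, lets the solver cancel terms such as (1 + m) − m.
module IntegerSolver {c ℓ} (R : CommutativeRing c ℓ) where
  open CommutativeRing R
  open SetoidReasoning setoid
  open NatCast R
  open import Algebra.Properties.Ring ring
    using (-0#≈0#; -‿involutive; -‿+-comm; -‿distribˡ-*; -‿distribʳ-*)
  import Algebra.Solver.Ring.AlmostCommutativeRing as ACR

  -- fromℕ, except that 1 is sent to 1# itself rather than to 1# + 0#, so
  -- that the solver's constant 1 denotes 1# on the nose.
  fromℕ′ : ℕ → Carrier
  fromℕ′ 1 = 1#
  fromℕ′ n = fromℕ n

  fromℕ′≈fromℕ : ∀ n → fromℕ′ n ≈ fromℕ n
  fromℕ′≈fromℕ 0             = refl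
  fromℕ′≈fromℕ 1             = sym (+-identityʳ 1#)
  fromℕ′≈fromℕ (suc (suc n)) = refl

  fromℤ : ℤ → Carrier
  fromℤ (+ n)    = fromℕ′ n
  fromℤ -[1+ n ] = - fromℕ (suc n)

  signed : Sign → Carrier → Carrier
  signed Sign.+ x = x
  signed Sign.- x = - x

  signed-cong : ∀ s {x y} → x ≈ y → signed s x ≈ signed s y
  signed-cong Sign.+ eq = eq
  signed-cong Sign.- eq = -‿cong eq

  signed-* : ∀ s t x y → signed s x * signed t y ≈ signed (s Sign.* t) (x * y)
  signed-* Sign.+ Sign.+ x y = refl
  signed-* Sign.+ Sign.- x y = sym (-‿distribʳ-* x y)
  signed-* Sign.- Sign.+ x y = sym (-‿distribˡ-* x y)
  signed-* Sign.- Sign.- x y = begin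
    - x * - y    ≈⟨ -‿distribˡ-* x (- y) ⟨
    - (x * - y)  ≈⟨ -‿cong (-‿distribʳ-* x y) ⟨
    - - (x * y)  ≈⟨ -‿involutive _ ⟩
    x * y        ∎

  fromℤ-◃ : ∀ s n → fromℤ (s ℤ.◃ n) ≈ signed s (fromℕ n)
  fromℤ-◃ Sign.+ zero    = refl
  fromℤ-◃ Sign.+ (suc n) = fromℕ′≈fromℕ (suc n)
  fromℤ-◃ Sign.- zero    = sym -0#≈0#
  fromℤ-◃ Sign.- (suc n) = refl

  fromℤ-signAbs : ∀ i → fromℤ i ≈ signed (ℤ.sign i) (fromℕ ℤ.∣ i ∣)
  fromℤ-signAbs (+ n)    = fromℕ′≈fromℕ n
  fromℤ-signAbs -[1+ n ] = refl

  fromℤ-* : ∀ i j → fromℤ (i ℤ.* j) ≈ fromℤ i * fromℤ j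
  fromℤ-* i j = begin
    fromℤ (i ℤ.* j)                          ≈⟨ fromℤ-◃ (ℤ.sign i Sign.* ℤ.sign j) (ℤ.∣ i ∣ ℕ.* ℤ.∣ j ∣) ⟩
    signed (ℤ.sign i Sign.* ℤ.sign j) _      ≈⟨ signed-cong (ℤ.sign i Sign.* ℤ.sign j) (fromℕ-* ℤ.∣ i ∣ ℤ.∣ j ∣) ⟩
    signed (ℤ.sign i Sign.* ℤ.sign j) _      ≈⟨ signed-* (ℤ.sign i) (ℤ.sign j) _ _ ⟨
    signed (ℤ.sign i) _ * signed (ℤ.sign j) _ ≈⟨ *-cong (fromℤ-signAbs i) (fromℤ-signAbs j) ⟨
    fromℤ i * fromℤ j                        ∎

  fromℤ-neg : ∀ i → fromℤ (ℤ.- i) ≈ - fromℤ i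
  fromℤ-neg -[1+ n ]    = trans (fromℕ′≈fromℕ (suc n)) (sym (-‿involutive _))
  fromℤ-neg (+ zero)    = sym -0#≈0#
  fromℤ-neg (+ (suc n)) = -‿cong (sym (fromℕ′≈fromℕ (suc n)))

  fromℤ-⊖ : ∀ m n → fromℤ (m ℤ.⊖ n) ≈ fromℕ m + - fromℕ n
  fromℤ-⊖ m zero rewrite ℤ.⊖-≥ {m} {0} ℕ.z≤n =
    trans (fromℕ′≈fromℕ m) (sym (trans (+-congˡ -0#≈0#) (+-identityʳ _)))
  fromℤ-⊖ zero (suc n) rewrite ℤ.⊖-< {0} {suc n} (ℕ.s≤s ℕ.z≤n) = sym (+-identityˡ _)
  fromℤ-⊖ (suc m) (suc n) rewrite ℤ.[1+m]⊖[1+n]≡m⊖n m n = begin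
    fromℤ (m ℤ.⊖ n)                           ≈⟨ fromℤ-⊖ m n ⟩
    fromℕ m + - fromℕ n                       ≈⟨ +-congʳ (+-identityˡ _) ⟨
    (0# + fromℕ m) + - fromℕ n                ≈⟨ +-congʳ (+-congʳ (-‿inverseʳ 1#)) ⟨
    ((1# + - 1#) + fromℕ m) + - fromℕ n       ≈⟨ +-congʳ (+-congʳ (+-comm 1# (- 1#))) ⟩
    ((- 1# + 1#) + fromℕ m) + - fromℕ n       ≈⟨ +-congʳ (+-assoc (- 1#) 1# _) ⟩
    (- 1# + fromℕ (suc m)) + - fromℕ n        ≈⟨ +-congʳ (+-comm (- 1#) _) ⟩
    (fromℕ (suc m) + - 1#) + - fromℕ n        ≈⟨ +-assoc _ _ _ ⟩
    fromℕ (suc m) + (- 1# + - fromℕ n)        ≈⟨ +-congˡ (-‿+-comm 1# (fromℕ n)) ⟩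
    fromℕ (suc m) + - fromℕ (suc n)           ∎

  fromℤ-+ : ∀ i j → fromℤ (i ℤ.+ j) ≈ fromℤ i + fromℤ j
  fromℤ-+ (+ m)    (+ n)    = begin
    fromℕ′ (m ℕ.+ n)         ≈⟨ fromℕ′≈fromℕ (m ℕ.+ n) ⟩
    fromℕ (m ℕ.+ n)          ≈⟨ fromℕ-+ m n ⟩
    fromℕ m + fromℕ n        ≈⟨ +-cong (fromℕ′≈fromℕ m) (fromℕ′≈fromℕ n) ⟨
    fromℕ′ m + fromℕ′ n      ∎
  fromℤ-+ (+ m)    -[1+ n ] = trans (fromℤ-⊖ m (suc n)) (+-congʳ (sym (fromℕ′≈fromℕ m)))
  fromℤ-+ -[1+ m ] (+ n)    =
    trans (fromℤ-⊖ n (suc m)) (trans (+-comm _ _) (+-congˡ (sym (fromℕ′≈fromℕ n))))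
  fromℤ-+ -[1+ m ] -[1+ n ] = begin
    - fromℕ (suc (suc (m ℕ.+ n)))        ≈⟨ -‿cong (reflexive (≡.cong (λ k → fromℕ (suc k)) (ℕ.+-suc m n))) ⟨
    - fromℕ (suc m ℕ.+ suc n)            ≈⟨ -‿cong (fromℕ-+ (suc m) (suc n)) ⟩
    - (fromℕ (suc m) + fromℕ (suc n))    ≈⟨ -‿+-comm _ _ ⟨
    - fromℕ (suc m) + - fromℕ (suc n)    ∎

  fromℤ-morphism : ℤ.+-*-rawRing ACR.-Raw-AlmostCommutative⟶ ACR.fromCommutativeRing R
  fromℤ-morphism = record
    { ⟦_⟧    = fromℤ
    ; +-homo = fromℤ-+
    ; *-homo = fromℤ-*
    ; -‿homo = fromℤ-neg
    ; 0-homo = refl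
    ; 1-homo = refl
    }

  fromℤ-≟ : ∀ i j → Maybe (fromℤ i ≈ fromℤ j)
  fromℤ-≟ i j with i ℤ.≟ j
  ... | yes i≡j = just (reflexive (≡.cong fromℤ i≡j))
  ... | no _    = nothing

  open import Algebra.Solver.Ring ℤ.+-*-rawRing (ACR.fromCommutativeRing R) fromℤ-morphism fromℤ-≟
    public using (solve; _:=_; _:+_; _:*_; _:-_; :-_; con; Polynomial)

  :0 :1 : ∀ {n} → Polynomial n
  :0 = con (+ 0)
  :1 = con (+ 1)

module Powers {c ℓ} (R : CommutativeRing c ℓ) where
  open CommutativeRing R
  open SetoidReasoning setoid
  open NatCast R
  open IntegerSolver R

  infixr 8 _^_
  _^_ : Carrier → ℕ → Carrier
  _^_ = _^ᴿ_ R

  ^-congˡ : ∀ {x y} n → x ≈ y → x ^ n ≈ y ^ n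
  ^-congˡ zero    eq = refl
  ^-congˡ (suc n) eq = *-cong eq (^-congˡ n eq)

  ^-homo-* : ∀ x m n → x ^ (m ℕ.+ n) ≈ x ^ m * x ^ n
  ^-homo-* x zero    n = sym (*-identityˡ _)
  ^-homo-* x (suc m) n = trans (*-congˡ (^-homo-* x m n)) (sym (*-assoc _ _ _))

  ^-distrib-* : ∀ x y n → (x * y) ^ n ≈ x ^ n * y ^ n
  ^-distrib-* x y zero    = sym (*-identityˡ 1#)
  ^-distrib-* x y (suc n) = trans (*-congˡ (^-distrib-* x y n))
    (solve 4 (λ x y a b → (x :* y) :* (a :* b) := (x :* a) :* (y :* b)) refl x y _ _)

  1^n≈1 : ∀ n → 1# ^ n ≈ 1#
  1^n≈1 zero    = refl
  1^n≈1 (suc n) = trans (*-identityˡ _) (1^n≈1 n)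

  ^-assocʳ : ∀ x m n → (x ^ m) ^ n ≈ x ^ (m ℕ.* n)
  ^-assocʳ x zero    n = 1^n≈1 n
  ^-assocʳ x (suc m) n = begin
    (x * x ^ m) ^ n           ≈⟨ ^-distrib-* x (x ^ m) n ⟩
    x ^ n * (x ^ m) ^ n       ≈⟨ *-congˡ (^-assocʳ x m n) ⟩
    x ^ n * x ^ (m ℕ.* n)     ≈⟨ ^-homo-* x n (m ℕ.* n) ⟨
    x ^ (n ℕ.+ m ℕ.* n)       ∎

  fromℕ-^ : ∀ p n → fromℕ (p ℕ.^ n) ≈ fromℕ p ^ n
  fromℕ-^ p zero    = +-identityʳ 1#
  fromℕ-^ p (suc n) = trans (fromℕ-* p (p ℕ.^ n)) (*-congˡ (fromℕ-^ p n))

module Units {c ℓ} (R : CommutativeRing c ℓ) where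
  open CommutativeRing R
  open SetoidReasoning setoid
  open IntegerSolver R
  open Powers R

  Unit-resp-≈ : ∀ {x y} → x ≈ y → Unit R x → Unit R y
  Unit-resp-≈ x≈y (z , xz≈1) = z , trans (*-congʳ (sym x≈y)) xz≈1

  Unit-1# : Unit R 1#
  Unit-1# = 1# , *-identityˡ 1#

  Unit-* : ∀ {x y} → Unit R x → Unit R y → Unit R (x * y)
  Unit-* {x} {y} (x' , xx'≈1) (y' , yy'≈1) = x' * y' , (begin
    (x * y) * (x' * y')   ≈⟨ solve 4 (λ x y a b → (x :* y) :* (a :* b) := (x :* a) :* (y :* b)) refl x y x' y' ⟩
    (x * x') * (y * y')   ≈⟨ *-cong xx'≈1 yy'≈1 ⟩
    1# * 1#               ≈⟨ *-identityˡ 1# ⟩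
    1#                    ∎)

  Unit-*⇒Unitˡ : ∀ {x y} → Unit R (x * y) → Unit R x
  Unit-*⇒Unitˡ {x} {y} (z , xyz≈1) = y * z , trans (sym (*-assoc x y z)) xyz≈1

  Unit-*⇒Unitʳ : ∀ {x y} → Unit R (x * y) → Unit R y
  Unit-*⇒Unitʳ {x} {y} u = Unit-*⇒Unitˡ (Unit-resp-≈ (*-comm x y) u)

  Unit-^ : ∀ {x} n → Unit R x → Unit R (x ^ n)
  Unit-^ zero    u = Unit-1#
  Unit-^ (suc n) u = Unit-* u (Unit-^ n u)

  Unit-neg : ∀ {x} → Unit R x → Unit R (- x)
  Unit-neg {x} (y , xy≈1) = - y , trans (solve 2 (λ x y → (:- x) :* (:- y) := x :* y) refl x y) xy≈1

  x*u≈0⇒x≈0 : ∀ {x u} → Unit R u → x * u ≈ 0# → x ≈ 0#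
  x*u≈0⇒x≈0 {x} {u} (u' , uu'≈1) xu≈0 = begin
    x               ≈⟨ *-identityʳ x ⟨
    x * 1#          ≈⟨ *-congˡ uu'≈1 ⟨
    x * (u * u')    ≈⟨ *-assoc x u u' ⟨
    (x * u) * u'    ≈⟨ *-congʳ xu≈0 ⟩
    0# * u'         ≈⟨ zeroˡ u' ⟩
    0#              ∎

  InMaxIdeal-resp-≈ : ∀ {x y} → x ≈ y → InMaxIdeal R x → InMaxIdeal R y
  InMaxIdeal-resp-≈ x≈y x∈m u = x∈m (Unit-resp-≈ (sym x≈y) u)

  InMaxIdeal-*ʳ : ∀ {x} y → InMaxIdeal R x → InMaxIdeal R (x * y)
  InMaxIdeal-*ʳ y x∈m u = x∈m (Unit-*⇒Unitˡ u)

  InMaxIdeal-*ˡ : ∀ x {y} → InMaxIdeal R y → InMaxIdeal R (x * y)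
  InMaxIdeal-*ˡ x y∈m u = y∈m (Unit-*⇒Unitʳ u)

  InMaxIdeal-neg : ∀ {x} → InMaxIdeal R x → InMaxIdeal R (- x)
  InMaxIdeal-neg {x} x∈m u = x∈m (Unit-resp-≈ (solve 1 (λ x → :- (:- x) := x) refl x) (Unit-neg u))

  InMaxIdeal-^ : ∀ {x} n → InMaxIdeal R x → InMaxIdeal R (x ^ suc n)
  InMaxIdeal-^ n = InMaxIdeal-*ʳ _

module ValuationRing {c ℓ} (R : CommutativeRing c ℓ) (valuationRing : IsValuationRing R) where
  open CommutativeRing R
  open SetoidReasoning setoid
  open NatCast R
  open import Data.Nat.Divisibility using (_∣_)
  open import Data.Nat.Coprimality using (Coprime; coprime-Bézout)
  open import Data.Nat.GCD using (module Bézout)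
  open import Data.Nat.Primality using (prime⇒irreducible)
  open IntegerSolver R
  open Powers R
  open Units R

  1#≉0# : ¬ (1# ≈ 0#)
  1#≉0# = proj₁ (proj₁ valuationRing)

  *-noZeroDivisors : ∀ x y → x * y ≈ 0# → x ≈ 0# ⊎ y ≈ 0#
  *-noZeroDivisors = proj₂ (proj₁ valuationRing)

  divides-total : ∀ x y → Divides R x y ⊎ Divides R y x
  divides-total = proj₂ valuationRing

  Unit-1+m : ∀ {m} → InMaxIdeal R m → Unit R (1# + m)
  Unit-1+m {m} m∈m with divides-total m (1# + m)
  ... | inj₁ (z , 1+m≈mz) = ⊥-elim (m∈m (z + - 1# , (begin
    m * (z + - 1#)     ≈⟨ solve 2 (λ m z → m :* (z :- :1) := m :* z :- m) refl m z ⟩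
    m * z + - m        ≈⟨ +-congʳ 1+m≈mz ⟨
    (1# + m) + - m     ≈⟨ solve 1 (λ m → (:1 :+ m) :- m := :1) refl m ⟩
    1#                 ∎)))
  ... | inj₂ (z , m≈[1+m]z) = 1# + - z , (begin
    (1# + m) * (1# + - z)          ≈⟨ solve 2 (λ m z → (:1 :+ m) :* (:1 :- z) := (:1 :+ m) :- (:1 :+ m) :* z) refl m z ⟩
    (1# + m) + - ((1# + m) * z)    ≈⟨ +-congˡ (-‿cong m≈[1+m]z) ⟨
    (1# + m) + - m                 ≈⟨ solve 1 (λ m → (:1 :+ m) :- m := :1) refl m ⟩
    1#                             ∎)

  Unit-+-InMaxIdeal : ∀ {u m} → Unit R u → InMaxIdeal R m → Unit R (u + m)
  Unit-+-InMaxIdeal {u} {m} (u' , uu'≈1) m∈m =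
    Unit-resp-≈ u[1+u'm]≈u+m (Unit-* (u' , uu'≈1) (Unit-1+m (InMaxIdeal-*ˡ u' m∈m)))
    where
    u[1+u'm]≈u+m : u * (1# + u' * m) ≈ u + m
    u[1+u'm]≈u+m = begin
      u * (1# + u' * m)   ≈⟨ solve 3 (λ u u' m → u :* (:1 :+ u' :* m) := u :+ (u :* u') :* m) refl u u' m ⟩
      u + (u * u') * m    ≈⟨ +-congˡ (trans (*-congʳ uu'≈1) (*-identityˡ m)) ⟩
      u + m               ∎

  InMaxIdeal-+-Unit : ∀ {m u} → InMaxIdeal R m → Unit R u → Unit R (m + u)
  InMaxIdeal-+-Unit m∈m u = Unit-resp-≈ (+-comm _ _) (Unit-+-InMaxIdeal u m∈m)

  *-cancelˡ : ∀ {a b c} → ¬ (a ≈ 0#) → a * b ≈ a * c → b ≈ c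
  *-cancelˡ {a} {b} {c} a≉0 ab≈ac with *-noZeroDivisors a (b + - c) (begin
    a * (b + - c)        ≈⟨ solve 3 (λ a b c → a :* (b :- c) := a :* b :- a :* c) refl a b c ⟩
    a * b + - (a * c)    ≈⟨ +-congʳ ab≈ac ⟩
    a * c + - (a * c)    ≈⟨ -‿inverseʳ _ ⟩
    0#                   ∎)
  ... | inj₁ a≈0   = ⊥-elim (a≉0 a≈0)
  ... | inj₂ b-c≈0 = begin
    b                    ≈⟨ solve 2 (λ b c → b := (b :- c) :+ c) refl b c ⟩
    (b + - c) + c        ≈⟨ +-congʳ b-c≈0 ⟩
    0# + c               ≈⟨ +-identityˡ c ⟩
    c                    ∎

  fromℕ-Unit : ∀ {p m} → Prime p → InMaxIdeal R (fromℕ p) → ¬ (p ∣ m) → Unit R (fromℕ m)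
  fromℕ-Unit {p} {m} p-prime p∈m p∤m with coprime-Bézout m-coprime-p
    where
    m-coprime-p : Coprime m p
    m-coprime-p (d∣m , d∣p) with prime⇒irreducible p-prime d∣p
    ... | inj₁ d≡1 = d≡1
    ... | inj₂ d≡p = ⊥-elim (p∤m (≡.subst (_∣ m) d≡p d∣m))
  ... | Bézout.+- x y 1+yp≡xm = Unit-*⇒Unitʳ (Unit-resp-≈ (begin
    1# + fromℕ y * fromℕ p      ≈⟨ +-congˡ (fromℕ-* y p) ⟨
    fromℕ (1 ℕ.+ y ℕ.* p)       ≡⟨ ≡.cong fromℕ 1+yp≡xm ⟩
    fromℕ (x ℕ.* m)             ≈⟨ fromℕ-* x m ⟩
    fromℕ x * fromℕ m           ∎) (Unit-1+m (InMaxIdeal-*ˡ (fromℕ y) p∈m)))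
  ... | Bézout.-+ x y 1+xm≡yp = Unit-*⇒Unitʳ (Unit-resp-≈ (begin
    - (1# + - (fromℕ y * fromℕ p))    ≈⟨ -‿cong (+-congˡ (-‿cong (fromℕ-* y p))) ⟨
    - (1# + - fromℕ (y ℕ.* p))        ≡⟨ ≡.cong (λ k → - (1# + - fromℕ k)) 1+xm≡yp ⟨
    - (1# + - (1# + fromℕ (x ℕ.* m))) ≈⟨ solve 1 (λ X → :- (:1 :- (:1 :+ X)) := X) refl _ ⟩
    fromℕ (x ℕ.* m)                   ≈⟨ fromℕ-* x m ⟩
    fromℕ x * fromℕ m                 ∎)
    (Unit-neg (Unit-1+m (InMaxIdeal-neg (InMaxIdeal-*ˡ (fromℕ y) p∈m)))))

  divides-antisym : ∀ {x y} → ¬ (x ≈ 0#) → Divides R x y → Divides R y x → ∃ λ w → Unit R w × y ≈ x * w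
  divides-antisym {x} {y} x≉0 (a , y≈xa) (b , x≈yb) = a , (b , sym 1≈ab) , y≈xa
    where
    1≈ab : 1# ≈ a * b
    1≈ab = *-cancelˡ x≉0 (begin
      x * 1#         ≈⟨ *-identityʳ x ⟩
      x              ≈⟨ x≈yb ⟩
      y * b          ≈⟨ *-congʳ y≈xa ⟩
      (x * a) * b    ≈⟨ *-assoc x a b ⟩
      x * (a * b)    ∎)

  ^-nonzero : ∀ {a} n → ¬ (a ≈ 0#) → ¬ (a ^ n ≈ 0#)
  ^-nonzero zero    a≉0 1≈0 = 1#≉0# 1≈0
  ^-nonzero (suc n) a≉0 aaⁿ≈0 with *-noZeroDivisors _ _ aaⁿ≈0
  ... | inj₁ a≈0  = a≉0 a≈0
  ... | inj₂ aⁿ≈0 = ^-nonzero n a≉0 aⁿ≈0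

module Polynomials {c ℓ} (R : CommutativeRing c ℓ) where
  open CommutativeRing R
  open SetoidReasoning setoid
  open NatCast R
  open IntegerSolver R
  open Powers R

  ⟦_⟧ : Poly R → Carrier → Carrier
  ⟦_⟧ = eval R

  infix 9 _′
  _′ : Poly R → Poly R
  _′ = deriv R

  ⟦⟧-cong : ∀ f {x y} → x ≈ y → ⟦ f ⟧ x ≈ ⟦ f ⟧ y
  ⟦⟧-cong []       x≈y = refl
  ⟦⟧-cong (a ∷ as) x≈y = +-congˡ (*-cong x≈y (⟦⟧-cong as x≈y))

  ⟦derivAux⟧-suc : ∀ k f x → ⟦ derivAux R (suc k) f ⟧ x ≈ ⟦ derivAux R 1 f ⟧ x + fromℕ k * ⟦ f ⟧ x
  ⟦derivAux⟧-suc k []       x = sym (trans (+-congˡ (zeroʳ _)) (+-identityʳ 0#))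
  ⟦derivAux⟧-suc k (a ∷ as) x = begin
    natMul R (suc k) a + x * ⟦ derivAux R (suc (suc k)) as ⟧ x
      ≈⟨ +-cong (natMul≈fromℕ* (suc k) a) (*-congˡ (⟦derivAux⟧-suc (suc k) as x)) ⟩
    fromℕ (suc k) * a + x * (D + fromℕ (suc k) * E)
      ≈⟨ solve 5 (λ a x D E k → (:1 :+ k) :* a :+ x :* (D :+ (:1 :+ k) :* E)
                             := (a :+ x :* (D :+ :1 :* E)) :+ k :* (a :+ x :* E)) refl a x D E (fromℕ k) ⟩
    (a + x * (D + 1# * E)) + fromℕ k * (a + x * E)
      ≈⟨ +-congʳ (+-cong (sym (+-identityʳ a)) (*-congˡ (sym (trans (⟦derivAux⟧-suc 1 as x)
                                                               (+-congˡ (*-congʳ (+-identityʳ 1#))))))) ⟩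
    (natMul R 1 a + x * ⟦ derivAux R 2 as ⟧ x) + fromℕ k * (a + x * E) ∎
    where
    D = ⟦ derivAux R 1 as ⟧ x
    E = ⟦ as ⟧ x

  ⟦′⟧-∷ : ∀ a as x → ⟦ (a ∷ as) ′ ⟧ x ≈ ⟦ as ⟧ x + x * ⟦ as ′ ⟧ x
  ⟦′⟧-∷ a []       x = sym (trans (+-identityˡ _) (zeroʳ x))
  ⟦′⟧-∷ a (b ∷ bs) x = begin
    natMul R 1 b + x * ⟦ derivAux R 2 bs ⟧ x   ≈⟨ +-cong (+-identityʳ b) (*-congˡ (⟦derivAux⟧-suc 1 bs x)) ⟩
    b + x * (D + fromℕ 1 * E)                  ≈⟨ +-congˡ (*-congˡ (+-congˡ (*-congʳ (+-identityʳ 1#)))) ⟩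
    b + x * (D + 1# * E)                       ≈⟨ solve 4 (λ b x D E → b :+ x :* (D :+ :1 :* E) := (b :+ x :* E) :+ x :* D) refl b x D E ⟩
    (b + x * E) + x * D                        ∎
    where
    D = ⟦ derivAux R 1 bs ⟧ x
    E = ⟦ bs ⟧ x

  infixl 6 _⊕_
  _⊕_ : Poly R → Poly R → Poly R
  []      ⊕ g       = g
  (a ∷ f) ⊕ []      = a ∷ f
  (a ∷ f) ⊕ (b ∷ g) = (a + b) ∷ (f ⊕ g)

  scale : Carrier → Poly R → Poly R
  scale k []      = []
  scale k (a ∷ f) = k * a ∷ scale k f

  ⟦⊕⟧ : ∀ f g x → ⟦ f ⊕ g ⟧ x ≈ ⟦ f ⟧ x + ⟦ g ⟧ x
  ⟦⊕⟧ []      g       x = sym (+-identityˡ _)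
  ⟦⊕⟧ (a ∷ f) []      x = sym (+-identityʳ _)
  ⟦⊕⟧ (a ∷ f) (b ∷ g) x = trans (+-congˡ (*-congˡ (⟦⊕⟧ f g x)))
    (solve 5 (λ a b x F G → (a :+ b) :+ x :* (F :+ G) := (a :+ x :* F) :+ (b :+ x :* G)) refl a b x _ _)

  ⟦scale⟧ : ∀ k f x → ⟦ scale k f ⟧ x ≈ k * ⟦ f ⟧ x
  ⟦scale⟧ k []      x = sym (zeroʳ k)
  ⟦scale⟧ k (a ∷ f) x = trans (+-congˡ (*-congˡ (⟦scale⟧ k f x)))
    (solve 4 (λ k a x F → k :* a :+ x :* (k :* F) := k :* (a :+ x :* F)) refl k a x _)

  ⟦derivAux⟧-⊕ : ∀ n f g x → ⟦ derivAux R n (f ⊕ g) ⟧ x ≈ ⟦ derivAux R n f ⟧ x + ⟦ derivAux R n g ⟧ x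
  ⟦derivAux⟧-⊕ n []      g       x = sym (+-identityˡ _)
  ⟦derivAux⟧-⊕ n (a ∷ f) []      x = sym (+-identityʳ _)
  ⟦derivAux⟧-⊕ n (a ∷ f) (b ∷ g) x = begin
    natMul R n (a + b) + x * ⟦ derivAux R (suc n) (f ⊕ g) ⟧ x
      ≈⟨ +-cong (natMul≈fromℕ* n (a + b)) (*-congˡ (⟦derivAux⟧-⊕ (suc n) f g x)) ⟩
    fromℕ n * (a + b) + x * (F + G)
      ≈⟨ solve 6 (λ k a b x F G → k :* (a :+ b) :+ x :* (F :+ G) := (k :* a :+ x :* F) :+ (k :* b :+ x :* G))
           refl (fromℕ n) a b x F G ⟩
    (fromℕ n * a + x * F) + (fromℕ n * b + x * G)
      ≈⟨ +-cong (+-congʳ (natMul≈fromℕ* n a)) (+-congʳ (natMul≈fromℕ* n b)) ⟨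
    (natMul R n a + x * F) + (natMul R n b + x * G) ∎
    where
    F = ⟦ derivAux R (suc n) f ⟧ x
    G = ⟦ derivAux R (suc n) g ⟧ x

  ⟦derivAux⟧-scale : ∀ n k f x → ⟦ derivAux R n (scale k f) ⟧ x ≈ k * ⟦ derivAux R n f ⟧ x
  ⟦derivAux⟧-scale n k []      x = sym (zeroʳ k)
  ⟦derivAux⟧-scale n k (a ∷ f) x = begin
    natMul R n (k * a) + x * ⟦ derivAux R (suc n) (scale k f) ⟧ x
      ≈⟨ +-cong (natMul≈fromℕ* n (k * a)) (*-congˡ (⟦derivAux⟧-scale (suc n) k f x)) ⟩
    fromℕ n * (k * a) + x * (k * F)
      ≈⟨ solve 5 (λ m k a x F → m :* (k :* a) :+ x :* (k :* F) := k :* (m :* a :+ x :* F)) refl (fromℕ n) k a x F ⟩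
    k * (fromℕ n * a + x * F)
      ≈⟨ *-congˡ (+-congʳ (natMul≈fromℕ* n a)) ⟨
    k * (natMul R n a + x * F) ∎
    where
    F = ⟦ derivAux R (suc n) f ⟧ x

  ⟦′⟧-⊕ : ∀ f g x → ⟦ (f ⊕ g) ′ ⟧ x ≈ ⟦ f ′ ⟧ x + ⟦ g ′ ⟧ x
  ⟦′⟧-⊕ []      g       x = sym (+-identityˡ _)
  ⟦′⟧-⊕ (a ∷ f) []      x = sym (+-identityʳ _)
  ⟦′⟧-⊕ (a ∷ f) (b ∷ g) x = ⟦derivAux⟧-⊕ 1 f g x

  ⟦′⟧-scale : ∀ k f x → ⟦ (scale k f) ′ ⟧ x ≈ k * ⟦ f ′ ⟧ x
  ⟦′⟧-scale k []      x = sym (zeroʳ k)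
  ⟦′⟧-scale k (a ∷ f) x = ⟦derivAux⟧-scale 1 k f x

  coeff-⊕ : ∀ f g i → coeff R (f ⊕ g) i ≈ coeff R f i + coeff R g i
  coeff-⊕ []      g       i       = sym (+-identityˡ _)
  coeff-⊕ (a ∷ f) []      zero    = sym (+-identityʳ _)
  coeff-⊕ (a ∷ f) []      (suc i) = sym (+-identityʳ _)
  coeff-⊕ (a ∷ f) (b ∷ g) zero    = refl
  coeff-⊕ (a ∷ f) (b ∷ g) (suc i) = coeff-⊕ f g i

  coeff-≥length : ∀ f i → length f ℕ.≤ i → coeff R f i ≈ 0#
  coeff-≥length []      i       _             = refl
  coeff-≥length (a ∷ f) (suc i) (ℕ.s≤s f≤i) = coeff-≥length f i f≤i

  length-scale : ∀ k f → length (scale k f) ≡ length f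
  length-scale k []      = ≡.refl
  length-scale k (a ∷ f) = ≡.cong suc (length-scale k f)

  length-⊕ : ∀ f g → length g ℕ.≤ length f → length (f ⊕ g) ≡ length f
  length-⊕ []      []      _             = ≡.refl
  length-⊕ (a ∷ f) []      _             = ≡.refl
  length-⊕ (a ∷ f) (b ∷ g) (ℕ.s≤s g≤f) = ≡.cong suc (length-⊕ f g g≤f)

  monicLinear-root : ∀ f → IsMonicOfDegree R f 1 → ∃ λ r → ⟦ f ⟧ r ≈ 0#
  monicLinear-root []                (() , _)
  monicLinear-root (a ∷ [])          (() , _)
  monicLinear-root (a ∷ b ∷ _ ∷ _)   (() , _)
  monicLinear-root (a ∷ b ∷ [])      (_ , b≈1) = - a , (begin
    a + - a * (b + - a * 0#)    ≈⟨ +-congˡ (*-congˡ (+-congʳ b≈1)) ⟩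
    a + - a * (1# + - a * 0#)   ≈⟨ solve 1 (λ a → a :+ (:- a) :* (:1 :+ (:- a) :* :0) := :0) refl a ⟩
    0#                          ∎)

  addConst : Carrier → Poly R → Poly R
  addConst k []       = k ∷ []
  addConst k (a ∷ as) = k + a ∷ as

  mulByXPlus : Carrier → Poly R → Poly R
  mulByXPlus x []       = []
  mulByXPlus x (a ∷ as) = x * a ∷ addConst a (mulByXPlus x as)

  ⟦addConst⟧ : ∀ k f h → ⟦ addConst k f ⟧ h ≈ k + ⟦ f ⟧ h
  ⟦addConst⟧ k []       h = +-congˡ (zeroʳ h)
  ⟦addConst⟧ k (a ∷ as) h = +-assoc k a _

  ⟦mulByXPlus⟧ : ∀ x f h → ⟦ mulByXPlus x f ⟧ h ≈ (x + h) * ⟦ f ⟧ h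
  ⟦mulByXPlus⟧ x []       h = sym (zeroʳ _)
  ⟦mulByXPlus⟧ x (a ∷ as) h = begin
    x * a + h * ⟦ addConst a (mulByXPlus x as) ⟧ h
      ≈⟨ +-congˡ (*-congˡ (trans (⟦addConst⟧ a (mulByXPlus x as) h) (+-congˡ (⟦mulByXPlus⟧ x as h)))) ⟩
    x * a + h * (a + (x + h) * ⟦ as ⟧ h)
      ≈⟨ solve 4 (λ x a h E → x :* a :+ h :* (a :+ (x :+ h) :* E) := (x :+ h) :* (a :+ h :* E)) refl x a h _ ⟩
    (x + h) * (a + h * ⟦ as ⟧ h) ∎

  length-addConst-mulByXPlus : ∀ x k f → length (addConst k (mulByXPlus x f)) ≡ suc (length f)
  length-addConst-mulByXPlus x k []       = ≡.refl
  length-addConst-mulByXPlus x k (a ∷ as) = ≡.cong suc (length-addConst-mulByXPlus x a as)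

  taylorRemainder : Carrier → Poly R → Poly R
  taylorRemainder x (a ∷ as@(_ ∷ _ ∷ _)) = addConst (⟦ as ′ ⟧ x) (mulByXPlus x (taylorRemainder x as))
  taylorRemainder x _                    = []

  length-taylorRemainder : ∀ x a b cs → length (taylorRemainder x (a ∷ b ∷ cs)) ≡ length cs
  length-taylorRemainder x a b []       = ≡.refl
  length-taylorRemainder x a b (c ∷ cs) =
    ≡.trans (length-addConst-mulByXPlus x _ (taylorRemainder x (b ∷ c ∷ cs)))
            (≡.cong suc (length-taylorRemainder x b c cs))

  taylor : ∀ f x h → ⟦ f ⟧ (x + h) ≈ (⟦ f ⟧ x + h * ⟦ f ′ ⟧ x) + (h * h) * ⟦ taylorRemainder x f ⟧ h
  taylor [] x h = solve 2 (λ x h → :0 := (:0 :+ h :* :0) :+ (h :* h) :* :0) refl x h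
  taylor (a ∷ []) x h =
    solve 3 (λ a x h → a :+ (x :+ h) :* :0 := (a :+ x :* :0 :+ h :* :0) :+ (h :* h) :* :0) refl a x h
  taylor (a ∷ b ∷ []) x h = begin
    a + (x + h) * (b + (x + h) * 0#)
      ≈⟨ solve 4 (λ a b x h → a :+ (x :+ h) :* (b :+ (x :+ h) :* :0)
                            := (a :+ x :* (b :+ x :* :0) :+ h :* (b :+ x :* :0)) :+ (h :* h) :* :0) refl a b x h ⟩
    (a + x * (b + x * 0#) + h * (b + x * 0#)) + (h * h) * 0#
      ≈⟨ +-congʳ (+-congˡ (*-congˡ (+-congʳ (sym (+-identityʳ b))))) ⟩
    (a + x * (b + x * 0#) + h * (natMul R 1 b + x * 0#)) + (h * h) * 0# ∎
  taylor (a ∷ as@(b ∷ c ∷ cs)) x h = begin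
    a + (x + h) * ⟦ as ⟧ (x + h)
      ≈⟨ +-congˡ (*-congˡ (taylor as x h)) ⟩
    a + (x + h) * ((G + h * G′) + (h * h) * Rg)
      ≈⟨ solve 6 (λ a x h G G′ Rg → a :+ (x :+ h) :* ((G :+ h :* G′) :+ (h :* h) :* Rg)
                   := ((a :+ x :* G) :+ h :* (G :+ x :* G′)) :+ (h :* h) :* (G′ :+ (x :+ h) :* Rg)) refl a x h G G′ Rg ⟩
    ((a + x * G) + h * (G + x * G′)) + (h * h) * (G′ + (x + h) * Rg)
      ≈⟨ +-cong (+-congˡ (*-congˡ (sym (⟦′⟧-∷ a as x))))
                (*-congˡ (sym (trans (⟦addConst⟧ G′ (mulByXPlus x Rᵍ) h) (+-congˡ (⟦mulByXPlus⟧ x Rᵍ h))))) ⟩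
    ((a + x * G) + h * ⟦ (a ∷ as) ′ ⟧ x) + (h * h) * ⟦ taylorRemainder x (a ∷ as) ⟧ h ∎
    where
    G  = ⟦ as ⟧ x
    G′ = ⟦ as ′ ⟧ x
    Rᵍ = taylorRemainder x as
    Rg = ⟦ Rᵍ ⟧ h

  -- Σᵢ lᵢ λⁱ Xᵏ⁻¹⁻ⁱ for l = (l₀, …, lₖ₋₁), the reversal of l(λX).
  scaledReversal : Carrier → Poly R → Poly R
  scaledReversal λ₀ []       = []
  scaledReversal λ₀ (l ∷ ls) = scale λ₀ (scaledReversal λ₀ ls) ++ (l ∷ [])

  length-++-[] : ∀ (f : Poly R) l → length (f ++ (l ∷ [])) ≡ suc (length f)
  length-++-[] []       l = ≡.refl
  length-++-[] (a ∷ as) l = ≡.cong suc (length-++-[] as l)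

  length-scaledReversal : ∀ λ₀ f → length (scaledReversal λ₀ f) ≡ length f
  length-scaledReversal λ₀ []       = ≡.refl
  length-scaledReversal λ₀ (l ∷ ls) = ≡.trans (length-++-[] (scale λ₀ (scaledReversal λ₀ ls)) l)
    (≡.cong suc (≡.trans (length-scale λ₀ (scaledReversal λ₀ ls)) (length-scaledReversal λ₀ ls)))

  ⟦++[]⟧ : ∀ f l w → ⟦ f ++ (l ∷ []) ⟧ w ≈ ⟦ f ⟧ w + l * w ^ length f
  ⟦++[]⟧ []       l w = begin
    l + w * 0#        ≈⟨ trans (+-congˡ (zeroʳ w)) (+-identityʳ l) ⟩
    l                 ≈⟨ trans (+-identityˡ _) (*-identityʳ l) ⟨
    0# + l * 1#       ∎
  ⟦++[]⟧ (a ∷ as) l w = trans (+-congˡ (*-congˡ (⟦++[]⟧ as l w)))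
    (solve 5 (λ a w E l Wn → a :+ w :* (E :+ l :* Wn) := (a :+ w :* E) :+ l :* (w :* Wn)) refl a w _ l _)

  ⟦scaledReversal⟧ : ∀ λ₀ f w v → w * v ≈ 1# →
                     ⟦ scaledReversal λ₀ f ⟧ w * w ≈ w ^ length f * ⟦ f ⟧ (λ₀ * v)
  ⟦scaledReversal⟧ λ₀ []       w v wv≈1 = trans (zeroˡ w) (sym (*-identityˡ 0#))
  ⟦scaledReversal⟧ λ₀ (l ∷ ls) w v wv≈1 = begin
    ⟦ scale λ₀ (scaledReversal λ₀ ls) ++ (l ∷ []) ⟧ w * w
      ≈⟨ *-congʳ (⟦++[]⟧ (scale λ₀ (scaledReversal λ₀ ls)) l w) ⟩
    (⟦ scale λ₀ (scaledReversal λ₀ ls) ⟧ w + l * w ^ length (scale λ₀ (scaledReversal λ₀ ls))) * w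
      ≈⟨ *-congʳ (+-cong (⟦scale⟧ λ₀ (scaledReversal λ₀ ls) w) (*-congˡ (reflexive (≡.cong (w ^_) length≡)))) ⟩
    (λ₀ * ⟦ scaledReversal λ₀ ls ⟧ w + l * wᵐ) * w
      ≈⟨ solve 5 (λ λ₀ S l Wm w → (λ₀ :* S :+ l :* Wm) :* w := λ₀ :* (S :* w) :+ l :* Wm :* w) refl λ₀ _ l wᵐ w ⟩
    λ₀ * (⟦ scaledReversal λ₀ ls ⟧ w * w) + l * wᵐ * w
      ≈⟨ +-congʳ (*-congˡ (⟦scaledReversal⟧ λ₀ ls w v wv≈1)) ⟩
    λ₀ * (wᵐ * E) + l * wᵐ * w
      ≈⟨ solve 5 (λ λ₀ Wm E l w → λ₀ :* (Wm :* E) :+ l :* Wm :* w := (w :* Wm) :* l :+ :1 :* (λ₀ :* Wm :* E))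
           refl λ₀ wᵐ E l w ⟩
    (w * wᵐ) * l + 1# * (λ₀ * wᵐ * E)
      ≈⟨ +-congˡ (*-congʳ wv≈1) ⟨
    (w * wᵐ) * l + (w * v) * (λ₀ * wᵐ * E)
      ≈⟨ solve 6 (λ λ₀ Wm E l w v → (w :* Wm) :* l :+ (w :* v) :* (λ₀ :* Wm :* E) := (w :* Wm) :* (l :+ (λ₀ :* v) :* E))
           refl λ₀ wᵐ E l w v ⟩
    (w * wᵐ) * (l + (λ₀ * v) * E) ∎
    where
    wᵐ = w ^ length ls
    E  = ⟦ ls ⟧ (λ₀ * v)
    length≡ : length (scale λ₀ (scaledReversal λ₀ ls)) ≡ length ls
    length≡ = ≡.trans (length-scale λ₀ (scaledReversal λ₀ ls)) (length-scaledReversal λ₀ ls)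

  Xᵏ[X+1] : ℕ → Poly R
  Xᵏ[X+1] zero    = 1# ∷ 1# ∷ []
  Xᵏ[X+1] (suc k) = 0# ∷ Xᵏ[X+1] k

  length-Xᵏ[X+1] : ∀ k → length (Xᵏ[X+1] k) ≡ suc (suc k)
  length-Xᵏ[X+1] zero    = ≡.refl
  length-Xᵏ[X+1] (suc k) = ≡.cong suc (length-Xᵏ[X+1] k)

  coeff-Xᵏ[X+1] : ∀ k → coeff R (Xᵏ[X+1] k) (suc k) ≈ 1#
  coeff-Xᵏ[X+1] zero    = refl
  coeff-Xᵏ[X+1] (suc k) = coeff-Xᵏ[X+1] k

  ⟦Xᵏ[X+1]⟧ : ∀ k w → ⟦ Xᵏ[X+1] k ⟧ w ≈ w ^ k * (w + 1#)
  ⟦Xᵏ[X+1]⟧ zero    w = solve 1 (λ w → :1 :+ w :* (:1 :+ w :* :0) := :1 :* (w :+ :1)) refl w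
  ⟦Xᵏ[X+1]⟧ (suc k) w = trans (+-identityˡ _) (trans (*-congˡ (⟦Xᵏ[X+1]⟧ k w)) (sym (*-assoc _ _ _)))

  ⟦Xᵏ[X+1]⟧-root : ∀ k → ⟦ Xᵏ[X+1] k ⟧ (- 1#) ≈ 0#
  ⟦Xᵏ[X+1]⟧-root k = trans (⟦Xᵏ[X+1]⟧ k (- 1#)) (trans (*-congˡ (-‿inverseˡ 1#)) (zeroʳ _))

  ⟦Xᵏ[X+1]′⟧-root : ∀ k → ⟦ Xᵏ[X+1] k ′ ⟧ (- 1#) ≈ (- 1#) ^ k
  ⟦Xᵏ[X+1]′⟧-root zero    = trans (+-congˡ (zeroʳ _)) (trans (+-identityʳ _) (+-identityʳ 1#))
  ⟦Xᵏ[X+1]′⟧-root (suc k) = begin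
    ⟦ (0# ∷ Xᵏ[X+1] k) ′ ⟧ (- 1#)                          ≈⟨ ⟦′⟧-∷ 0# (Xᵏ[X+1] k) (- 1#) ⟩
    ⟦ Xᵏ[X+1] k ⟧ (- 1#) + - 1# * ⟦ Xᵏ[X+1] k ′ ⟧ (- 1#)   ≈⟨ +-cong (⟦Xᵏ[X+1]⟧-root k) (*-congˡ (⟦Xᵏ[X+1]′⟧-root k)) ⟩
    0# + - 1# * (- 1#) ^ k                                 ≈⟨ +-identityˡ _ ⟩
    (- 1#) ^ suc k                                         ∎

-- Henselianity only lifts simple roots, so it is applied to an
-- auxiliary monic polynomial q of the same degree with the simple root
-- −1 modulo 𝔪: writing r = x + f′(x) c w⁻¹ and expanding f(r) by Taylor,
-- f(r) wⁿ = f′(x)² c q(w) where q = Xⁿ⁻¹(X + 1) + c · (reversed remainder).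
module Newton {c ℓ} (R : CommutativeRing c ℓ) (valuationRing : IsValuationRing R)
                    (henselian : IsHenselian R) where
  open CommutativeRing R
  open SetoidReasoning setoid
  open IntegerSolver R
  open Powers R
  open Units R
  open ValuationRing R valuationRing
  open Polynomials R

  newton : ∀ f m → IsMonicOfDegree R f (suc m) → ∀ x c →
           ⟦ f ⟧ x ≈ (⟦ f ′ ⟧ x * ⟦ f ′ ⟧ x) * c → InMaxIdeal R c → ∃ λ r → ⟦ f ⟧ r ≈ 0#
  newton []       m (() , _)
  newton (a ∷ []) m (() , _)
  newton f@(a ∷ b ∷ cs) m (length-f , _) x c f[x]≈D²c c∈m = x + h , x*u≈0⇒x≈0 (Unit-* w-unit (Unit-^ m w-unit)) f[r]wᵐ⁺¹≈0
    where
    D : Carrier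
    D = ⟦ f ′ ⟧ x

    Rᶠ : Poly R
    Rᶠ = taylorRemainder x f

    length-Rᶠ : length Rᶠ ≡ m
    length-Rᶠ = ≡.trans (length-taylorRemainder x a b cs) (ℕ.suc-injective (ℕ.suc-injective length-f))

    M : Poly R
    M = scaledReversal (D * c) Rᶠ

    q : Poly R
    q = Xᵏ[X+1] m ⊕ scale c M

    length-cM : length (scale c M) ≡ m
    length-cM = ≡.trans (length-scale c M) (≡.trans (length-scaledReversal (D * c) Rᶠ) length-Rᶠ)

    length-cM≤ : length (scale c M) ℕ.≤ suc m
    length-cM≤ = ℕ.≤-trans (ℕ.≤-reflexive length-cM) (ℕ.n≤1+n m)

    q-monic : IsMonicOfDegree R q (suc m)
    q-monic = ≡.trans (length-⊕ (Xᵏ[X+1] m) (scale c M) length-cM≤′) (length-Xᵏ[X+1] m) , (begin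
      coeff R q (suc m)                                           ≈⟨ coeff-⊕ (Xᵏ[X+1] m) (scale c M) (suc m) ⟩
      coeff R (Xᵏ[X+1] m) (suc m) + coeff R (scale c M) (suc m)   ≈⟨ +-cong (coeff-Xᵏ[X+1] m) (coeff-≥length (scale c M) (suc m) length-cM≤) ⟩
      1# + 0#                                                     ≈⟨ +-identityʳ 1# ⟩
      1#                                                          ∎)
      where
      length-cM≤′ : length (scale c M) ℕ.≤ length (Xᵏ[X+1] m)
      length-cM≤′ = ℕ.≤-trans length-cM≤ (ℕ.≤-trans (ℕ.n≤1+n (suc m)) (ℕ.≤-reflexive (≡.sym (length-Xᵏ[X+1] m))))

    ⟦q⟧ : ∀ w → ⟦ q ⟧ w ≈ w ^ m * (w + 1#) + c * ⟦ M ⟧ w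
    ⟦q⟧ w = trans (⟦⊕⟧ (Xᵏ[X+1] m) (scale c M) w) (+-cong (⟦Xᵏ[X+1]⟧ m w) (⟦scale⟧ c M w))

    q[-1]∈m : InMaxIdeal R (⟦ q ⟧ (- 1#))
    q[-1]∈m = InMaxIdeal-resp-≈ (sym (trans (⟦⊕⟧ (Xᵏ[X+1] m) (scale c M) (- 1#))
      (trans (+-cong (⟦Xᵏ[X+1]⟧-root m) (⟦scale⟧ c M (- 1#))) (+-identityˡ _)))) (InMaxIdeal-*ʳ _ c∈m)

    q′[-1]-unit : Unit R (⟦ q ′ ⟧ (- 1#))
    q′[-1]-unit = Unit-resp-≈
      (sym (trans (⟦′⟧-⊕ (Xᵏ[X+1] m) (scale c M) (- 1#)) (+-cong (⟦Xᵏ[X+1]′⟧-root m) (⟦′⟧-scale c M (- 1#)))))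
      (Unit-+-InMaxIdeal (Unit-^ m (Unit-neg Unit-1#)) (InMaxIdeal-*ʳ _ c∈m))

    lift : ∃ λ w → ⟦ q ⟧ w ≈ 0# × InMaxIdeal R (w + - (- 1#))
    lift = henselian q (suc m) q-monic (- 1#) q[-1]∈m q′[-1]-unit

    w : Carrier
    w = proj₁ lift

    w-unit : Unit R w
    w-unit = Unit-resp-≈ (solve 1 (λ w → (:- :1) :+ (w :- (:- :1)) := w) refl w)
                         (Unit-+-InMaxIdeal (Unit-neg Unit-1#) (proj₂ (proj₂ lift)))

    v : Carrier
    v = proj₁ w-unit

    wv≈1 : w * v ≈ 1#
    wv≈1 = proj₂ w-unit

    h : Carrier
    h = D * (c * v)

    wᵐ Rₕ : Carrier
    wᵐ = w ^ m
    Rₕ = ⟦ Rᶠ ⟧ h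

    M[w]w≈wᵐRₕ : ⟦ M ⟧ w * w ≈ wᵐ * Rₕ
    M[w]w≈wᵐRₕ = begin
      ⟦ M ⟧ w * w                      ≈⟨ ⟦scaledReversal⟧ (D * c) Rᶠ w v wv≈1 ⟩
      w ^ length Rᶠ * ⟦ Rᶠ ⟧ ((D * c) * v) ≈⟨ *-cong (reflexive (≡.cong (w ^_) length-Rᶠ)) (⟦⟧-cong Rᶠ (*-assoc D c v)) ⟩
      wᵐ * Rₕ                          ∎

    f[r]wᵐ⁺¹≈0 : ⟦ f ⟧ (x + h) * (w * wᵐ) ≈ 0#
    f[r]wᵐ⁺¹≈0 = begin
      ⟦ f ⟧ (x + h) * (w * wᵐ)
        ≈⟨ *-congʳ (trans (taylor f x h) (+-congʳ (+-congʳ f[x]≈D²c))) ⟩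
      (((D * D) * c + h * D) + (h * h) * Rₕ) * (w * wᵐ)
        ≈⟨ solve 6 (λ D c v w Wm Rh → (((D :* D) :* c :+ (D :* (c :* v)) :* D) :+ ((D :* (c :* v)) :* (D :* (c :* v))) :* Rh) :* (w :* Wm)
               := ((D :* D) :* c) :* (w :* Wm) :+ ((D :* D) :* c :* Wm) :* (w :* v) :+ ((D :* D) :* c :* c :* v :* v :* w) :* (Wm :* Rh))
               refl D c v w wᵐ Rₕ ⟩
      ((D * D) * c) * (w * wᵐ) + ((D * D) * c * wᵐ) * (w * v) + ((D * D) * c * c * v * v * w) * (wᵐ * Rₕ)
        ≈⟨ +-cong (+-congˡ (*-congˡ wv≈1)) (*-congˡ (sym M[w]w≈wᵐRₕ)) ⟩
      ((D * D) * c) * (w * wᵐ) + ((D * D) * c * wᵐ) * 1# + ((D * D) * c * c * v * v * w) * (⟦ M ⟧ w * w)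
        ≈⟨ solve 6 (λ D c v w Wm Mw → ((D :* D) :* c) :* (w :* Wm) :+ ((D :* D) :* c :* Wm) :* :1 :+ ((D :* D) :* c :* c :* v :* v :* w) :* (Mw :* w)
               := ((D :* D) :* c) :* (Wm :* (w :+ :1)) :+ ((D :* D) :* c :* c :* Mw) :* ((w :* v) :* (w :* v)))
               refl D c v w wᵐ (⟦ M ⟧ w) ⟩
      ((D * D) * c) * (wᵐ * (w + 1#)) + ((D * D) * c * c * ⟦ M ⟧ w) * ((w * v) * (w * v))
        ≈⟨ +-congˡ (*-congˡ (trans (*-cong wv≈1 wv≈1) (*-identityˡ 1#))) ⟩
      ((D * D) * c) * (wᵐ * (w + 1#)) + ((D * D) * c * c * ⟦ M ⟧ w) * 1#
        ≈⟨ solve 5 (λ D c w Wm Mw → ((D :* D) :* c) :* (Wm :* (w :+ :1)) :+ ((D :* D) :* c :* c :* Mw) :* :1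
               := ((D :* D) :* c) :* (Wm :* (w :+ :1) :+ c :* Mw)) refl D c w wᵐ (⟦ M ⟧ w) ⟩
      ((D * D) * c) * (wᵐ * (w + 1#) + c * ⟦ M ⟧ w)
        ≈⟨ *-congˡ (sym (⟦q⟧ w)) ⟩
      ((D * D) * c) * ⟦ q ⟧ w
        ≈⟨ *-congˡ (proj₁ (proj₂ lift)) ⟩
      ((D * D) * c) * 0#
        ≈⟨ zeroʳ _ ⟩
      0# ∎

module PAdicValuation (q : ℕ) where
  open import Data.Nat.Divisibility using (_∣_; _∣?_)
  open import Data.Nat.DivMod using (_/_; m*[n/m]≡n; m/n<m)

  p : ℕ
  p = suc (suc q)

  vpAux-factorisation : ∀ fuel n → 1 ℕ.≤ n → n ℕ.≤ fuel →
                        ∃ λ m → n ≡ p ℕ.^ vpAux p fuel n ℕ.* m × ¬ (p ∣ m)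
  vpAux-factorisation zero       (suc n) _ ()
  vpAux-factorisation (suc fuel) (suc n) _ n≤fuel with p ∣? suc n
  ... | no p∤n = suc n , ≡.sym (ℕ.*-identityˡ (suc n)) , p∤n
  ... | yes p∣n = m , (begin
    suc n                  ≡⟨ m*[n/m]≡n p∣n ⟨
    p ℕ.* k                ≡⟨ ≡.cong (p ℕ.*_) k≡pᵛm ⟩
    p ℕ.* (p ℕ.^ v ℕ.* m)  ≡⟨ ℕ.*-assoc p (p ℕ.^ v) m ⟨
    p ℕ.^ suc v ℕ.* m      ∎) , p∤m
    where
    open ≡.≡-Reasoning
    k = suc n / p

    1≤k : 1 ℕ.≤ k
    1≤k = ℕ.n≢0⇒n>0 λ k≡0 → ℕ.0≢1+n (≡.trans (≡.sym (ℕ.*-zeroʳ p))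
                                       (≡.trans (≡.cong (p ℕ.*_) (≡.sym k≡0)) (m*[n/m]≡n p∣n)))

    k≤fuel : k ℕ.≤ fuel
    k≤fuel = ℕ.≤-trans (ℕ.≤-pred (m/n<m (suc n) p (ℕ.s≤s (ℕ.s≤s ℕ.z≤n)))) (ℕ.≤-pred n≤fuel)

    IH = vpAux-factorisation fuel k 1≤k k≤fuel
    v = vpAux p fuel k
    m = proj₁ IH
    k≡pᵛm = proj₁ (proj₂ IH)
    p∤m = proj₂ (proj₂ IH)

  vp-factorisation : ∀ n → ∃ λ m → suc n ≡ p ℕ.^ vp p (suc n) ℕ.* m × ¬ (p ∣ m)
  vp-factorisation n = vpAux-factorisation (suc n) (suc n) (ℕ.s≤s ℕ.z≤n) ℕ.≤-refl

module OrderArithmetic where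
  open import Data.Nat.Tactic.RingSolver using (solve-∀)
  open import Data.Nat.DivMod using (_%_; m<n⇒m%n≡m; [m+kn]%n≡m%n)
  open ℕ.≤-Reasoning

  remainder-unique : ∀ e a b r t → r ℕ.< e → t ℕ.< e → e ℕ.* a ℕ.+ r ≡ e ℕ.* b ℕ.+ t → r ≡ t
  remainder-unique (suc e) a b r t r<e t<e ea+r≡eb+t = begin-equality
    r                         ≡⟨ m<n⇒m%n≡m r<e ⟨
    r % suc e                 ≡⟨ mod-absorbs a r ⟨
    (suc e ℕ.* a ℕ.+ r) % suc e ≡⟨ ≡.cong (_% suc e) ea+r≡eb+t ⟩
    (suc e ℕ.* b ℕ.+ t) % suc e ≡⟨ mod-absorbs b t ⟩
    t % suc e                 ≡⟨ m<n⇒m%n≡m t<e ⟩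
    t                         ∎
    where
    mod-absorbs : ∀ a r → (suc e ℕ.* a ℕ.+ r) % suc e ≡ r % suc e
    mod-absorbs a r = ≡.trans (≡.cong (_% suc e) (≡.trans (ℕ.+-comm (suc e ℕ.* a) r) (≡.cong (r ℕ.+_) (ℕ.*-comm (suc e) a))))
                              ([m+kn]%n≡m%n r a (suc e))

  <e*[2+v] : ∀ e₁ v K s → K ℕ.+ suc s ℕ.≤ suc e₁ ℕ.* v ℕ.+ e₁ → suc K ℕ.< suc e₁ ℕ.* suc (suc v)
  <e*[2+v] e₁ v K s bound = begin
    suc (suc K)                   ≤⟨ ℕ.s≤s (ℕ.s≤s (ℕ.m≤m+n K s)) ⟩
    suc (suc (K ℕ.+ s))           ≡⟨ ≡.cong suc (ℕ.+-suc K s) ⟨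
    suc (K ℕ.+ suc s)             ≤⟨ ℕ.s≤s bound ⟩
    suc (e ℕ.* v ℕ.+ e₁)          ≡⟨ ℕ.+-suc (e ℕ.* v) e₁ ⟨
    e ℕ.* v ℕ.+ e                 ≤⟨ ℕ.m≤m+n _ e ⟩
    (e ℕ.* v ℕ.+ e) ℕ.+ e         ≡⟨ identity e v ⟨
    e ℕ.* suc (suc v)             ∎
    where
    e = suc e₁
    identity : ∀ e v → e ℕ.* suc (suc v) ≡ (e ℕ.* v ℕ.+ e) ℕ.+ e
    identity = solve-∀

  2K<e*d : ∀ e₂ v K → K ℕ.≤ suc (suc e₂) ℕ.* v ℕ.+ suc e₂ →
           K ℕ.+ K ℕ.< suc (suc e₂) ℕ.* (suc (suc e₂) ℕ.* suc v)
  2K<e*d e₂ v K bound = begin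
    suc (K ℕ.+ K)                       ≤⟨ ℕ.s≤s (ℕ.+-mono-≤ bound bound) ⟩
    suc (X ℕ.+ X)                       ≤⟨ ℕ.s≤s (ℕ.+-monoʳ-≤ X (ℕ.n≤1+n X)) ⟩
    suc X ℕ.+ suc X                     ≡⟨ ≡.cong₂ ℕ._+_ (ℕ.+-suc (e ℕ.* v) e₁) (ℕ.+-suc (e ℕ.* v) e₁) ⟨
    (e ℕ.* v ℕ.+ e) ℕ.+ (e ℕ.* v ℕ.+ e) ≡⟨ identity e v ⟩
    2 ℕ.* (e ℕ.* suc v)                 ≤⟨ ℕ.*-monoˡ-≤ (e ℕ.* suc v) (ℕ.s≤s (ℕ.s≤s (ℕ.z≤n {e₂}))) ⟩
    e ℕ.* (e ℕ.* suc v)                 ∎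
    where
    e₁ = suc e₂
    e = suc e₁
    X = e ℕ.* v ℕ.+ e₁
    identity : ∀ e v → (e ℕ.* v ℕ.+ e) ℕ.+ (e ℕ.* v ℕ.+ e) ≡ 2 ℕ.* (e ℕ.* suc v)
    identity = solve-∀

module XAdicOrder {c ℓ} (R : CommutativeRing c ℓ) (valuationRing : IsValuationRing R)
                  (x : CommutativeRing.Carrier R) where
  open CommutativeRing R
  open SetoidReasoning setoid
  open IntegerSolver R
  open Powers R
  open Units R
  open ValuationRing R valuationRing

  record HasOrder (s : Carrier) (k : ℕ) : Set (c Level.⊔ ℓ) where
    constructor hasOrder
    field
      unit      : Carrier
      isUnit    : Unit R unit
      factorise : s ≈ x ^ k * unit

  OrderAbove : Carrier → ℕ → Set (c Level.⊔ ℓ)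
  OrderAbove s k = Divides R (x ^ suc k) s

  x^-split : ∀ {k k′} → k ℕ.≤ k′ → x ^ k′ ≈ x ^ k * x ^ (k′ ℕ.∸ k)
  x^-split {k} {k′} k≤k′ = trans (reflexive (≡.cong (x ^_) (≡.sym (ℕ.m+[n∸m]≡n k≤k′)))) (^-homo-* x k (k′ ℕ.∸ k))

  HasOrder-resp-≈ : ∀ {s t k} → s ≈ t → HasOrder s k → HasOrder t k
  HasOrder-resp-≈ s≈t (hasOrder u u-unit s≈xᵏu) = hasOrder u u-unit (trans (sym s≈t) s≈xᵏu)

  x^-divides⇒OrderAbove : ∀ {s k k′} → Divides R (x ^ k′) s → k ℕ.< k′ → OrderAbove s k
  x^-divides⇒OrderAbove {s} {k} {k′} (w , s≈xᵏ′w) k<k′ =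
    x ^ (k′ ℕ.∸ suc k) * w , trans s≈xᵏ′w (trans (*-congʳ (x^-split k<k′)) (*-assoc _ _ w))

  HasOrder⇒OrderAbove : ∀ {s k k′} → HasOrder s k′ → k ℕ.< k′ → OrderAbove s k
  HasOrder⇒OrderAbove (hasOrder u _ s≈xᵏ′u) = x^-divides⇒OrderAbove (u , s≈xᵏ′u)

  HasOrder-+-OrderAbove : ∀ {s t k} → InMaxIdeal R x → HasOrder s k → OrderAbove t k → HasOrder (s + t) k
  HasOrder-+-OrderAbove {s} {t} {k} x∈m (hasOrder u u-unit s≈xᵏu) (w , t≈xᵏ⁺¹w) =
    hasOrder (u + x * w) (Unit-+-InMaxIdeal u-unit (InMaxIdeal-*ʳ w x∈m)) (begin
      s + t                          ≈⟨ +-cong s≈xᵏu t≈xᵏ⁺¹w ⟩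
      x ^ k * u + (x * x ^ k) * w    ≈⟨ solve 4 (λ X x u w → X :* u :+ (x :* X) :* w := X :* (u :+ x :* w)) refl (x ^ k) x u w ⟩
      x ^ k * (u + x * w)            ∎)

  OrderAbove-+-HasOrder : ∀ {s t k} → InMaxIdeal R x → OrderAbove s k → HasOrder t k → HasOrder (s + t) k
  OrderAbove-+-HasOrder x∈m s>k t=k = HasOrder-resp-≈ (+-comm _ _) (HasOrder-+-OrderAbove x∈m t=k s>k)

  HasOrder-x* : ∀ {s k} → HasOrder s k → HasOrder (x * s) (suc k)
  HasOrder-x* (hasOrder u u-unit s≈xᵏu) = hasOrder u u-unit (trans (*-congˡ s≈xᵏu) (sym (*-assoc x _ u)))

module UnramifiedDVR {a ℓa} (A : CommutativeRing a ℓa) (q : ℕ)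
                     (unramified : IsUnramifiedDVR A (suc (suc q))) where
  open CommutativeRing A
  open SetoidReasoning setoid
  open NatCast A
  open IntegerSolver A
  open Powers A
  open Units A

  valuationRing : IsValuationRing A
  valuationRing = proj₁ (proj₁ unramified)

  open ValuationRing A valuationRing

  pᴬ : Carrier
  pᴬ = fromℕ (suc (suc q))

  pᴬ≉0 : ¬ (pᴬ ≈ 0#)
  pᴬ≉0 = proj₁ (proj₂ unramified) (suc q)

  pᴬ∈m : InMaxIdeal A pᴬ
  pᴬ∈m = proj₁ (proj₂ (proj₂ unramified))

  pᴬ-uniformizer : IsUniformizer A pᴬ
  pᴬ-uniformizer = proj₂ (proj₂ (proj₂ unramified))

  uniformizer≈pᴬ*unit : ∀ {π} → IsUniformizer A π → ∃ λ w → Unit A w × π ≈ pᴬ * w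
  uniformizer≈pᴬ*unit (π∈m , π-divides-m) =
    divides-antisym pᴬ≉0 (proj₂ pᴬ-uniformizer _ π∈m) (π-divides-m pᴬ pᴬ∈m)

  nonzero≈unit*pᴬ^ : ∀ x → ¬ (x ≈ 0#) → ∃ λ n → ∃ λ u → Unit A u × x ≈ u * pᴬ ^ n
  nonzero≈unit*pᴬ^ x x≉0 with proj₂ (proj₁ unramified)
  ... | π , _ , π∈m , π-powers with π-powers x x≉0 | π-uniformizer
    where
    π-uniformizer : ∃ λ w → Unit A w × π ≈ pᴬ * w
    π-uniformizer with π-powers pᴬ pᴬ≉0
    ... | zero  , u , u-unit , pᴬ≈u*1 = ⊥-elim (pᴬ∈m (Unit-resp-≈ (sym (trans pᴬ≈u*1 (*-identityʳ u))) u-unit))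
    ... | suc n , u , _      , pᴬ≈uπⁿ⁺¹ = divides-antisym pᴬ≉0 (proj₂ pᴬ-uniformizer π π∈m)
      (u * π ^ n , trans pᴬ≈uπⁿ⁺¹ (solve 3 (λ u π πⁿ → u :* (π :* πⁿ) := π :* (u :* πⁿ)) refl u π (π ^ n)))
  ... | n , u , u-unit , x≈uπⁿ | w , w-unit , π≈pᴬw =
    n , u * w ^ n , Unit-* u-unit (Unit-^ n w-unit) , (begin
      x                    ≈⟨ x≈uπⁿ ⟩
      u * π ^ n            ≈⟨ *-congˡ (trans (^-congˡ n π≈pᴬw) (^-distrib-* pᴬ w n)) ⟩
      u * (pᴬ ^ n * w ^ n) ≈⟨ solve 3 (λ u X Y → u :* (X :* Y) := (u :* Y) :* X) refl u (pᴬ ^ n) (w ^ n) ⟩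
      (u * w ^ n) * pᴬ ^ n ∎)

  pᴬ^-divides-or-≈unit*pᴬ^ : ∀ N x → Divides A (pᴬ ^ N) x ⊎ ∃ λ n → ∃ λ u → Unit A u × x ≈ u * pᴬ ^ n
  pᴬ^-divides-or-≈unit*pᴬ^ N x with divides-total x (pᴬ ^ N)
  ... | inj₂ pᴺ∣x          = inj₁ pᴺ∣x
  ... | inj₁ (z , pᴺ≈xz) = inj₂ (nonzero≈unit*pᴬ^ x λ x≈0 →
    ^-nonzero N pᴬ≉0 (trans pᴺ≈xz (trans (*-congʳ x≈0) (zeroˡ z))))

module Extension {a ℓa b ℓb} (A : CommutativeRing a ℓa) (B : CommutativeRing b ℓb)
                 (φ : CommutativeRing.Carrier A → CommutativeRing.Carrier B)
                 (extension : IsExtension A B φ) where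
  private
    module A = CommutativeRing A
    module Aᵖ = Powers A
  open CommutativeRing B
  open NatCast B
  open Powers B
  open import Algebra.Morphism.Structures using (module RingMorphisms)
  open RingMorphisms.IsRingMonomorphism (proj₁ extension) public
    using () renaming (⟦⟧-cong to φ-cong; +-homo to φ-+; *-homo to φ-*; 0#-homo to φ-0#; 1#-homo to φ-1#)

  φ-natMul : ∀ k x → φ (natMul A k x) ≈ natMul B k (φ x)
  φ-natMul zero    x = φ-0#
  φ-natMul (suc k) x = trans (φ-+ x _) (+-congˡ (φ-natMul k x))

  φ-fromℕ : ∀ k → φ (NatCast.fromℕ A k) ≈ fromℕ k
  φ-fromℕ zero    = φ-0#
  φ-fromℕ (suc k) = trans (φ-+ A.1# _) (+-cong φ-1# (φ-fromℕ k))

  φ-^ : ∀ x n → φ (x Aᵖ.^ n) ≈ φ x ^ n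
  φ-^ x zero    = φ-1#
  φ-^ x (suc n) = trans (φ-* x _) (*-congˡ (φ-^ x n))

  φ-Unit : ∀ {u} → Unit A u → Unit B (φ u)
  φ-Unit {u} (u′ , uu′≈1) = φ u′ , trans (sym (φ-* u u′)) (trans (φ-cong uu′≈1) φ-1#)

  φ-InMaxIdeal : ∀ {x} → InMaxIdeal A x → InMaxIdeal B (φ x)
  φ-InMaxIdeal {x} = proj₁ (proj₂ extension x)

  coeff-map : ∀ f i → coeff B (map φ f) i ≈ φ (coeff A f i)
  coeff-map []      i       = sym φ-0#
  coeff-map (a ∷ f) zero    = refl
  coeff-map (a ∷ f) (suc i) = coeff-map f i

  map-monic : ∀ {f n} → IsMonicOfDegree A f n → IsMonicOfDegree B (map φ f) n
  map-monic {f} {n} (length-f , leading≈1) =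
    ≡.trans (length-map φ f) length-f , trans (coeff-map f n) (trans (φ-cong leading≈1) φ-1#)

module ReductionModP {a ℓa b ℓb} (q : ℕ) (A : CommutativeRing a ℓa) (B : CommutativeRing b ℓb)
                     (unramified : IsUnramifiedDVR A (suc (suc q)))
                     (φ : CommutativeRing.Carrier A → CommutativeRing.Carrier B)
                     (extension : IsExtension A B φ) where
  private
    module A = CommutativeRing A
  open CommutativeRing B
  open SetoidReasoning setoid
  open NatCast B
  open IntegerSolver B
  open Powers B
  open Polynomials B
  open UnramifiedDVR A q unramified
  open Extension A B φ extension

  pᴮ : Carrier
  pᴮ = fromℕ (suc (suc q))

  φ-pᴬ : φ pᴬ ≈ pᴮ
  φ-pᴬ = φ-fromℕ (suc (suc q))

  φ-pᴬ* : ∀ {a w} → a A.≈ pᴬ A.* w → φ a ≈ pᴮ * φ w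
  φ-pᴬ* {a} {w} a≈pᴬw = trans (φ-cong a≈pᴬw) (trans (φ-* pᴬ w) (*-congʳ φ-pᴬ))

  ⟦map⟧≈xⁿ-mod-pᴮ : ∀ n f → IsMonicOfDegree A f n → (∀ i → i ℕ.< n → InMaxIdeal A (coeff A f i)) →
                      ∀ x → ∃ λ y → ⟦ map φ f ⟧ x ≈ pᴮ * y + x ^ n
  ⟦map⟧≈xⁿ-mod-pᴮ zero (a ∷ []) (_ , a≈1) _ x = 0# , (begin
    φ a + x * 0#     ≈⟨ +-cong (trans (φ-cong a≈1) φ-1#) (zeroʳ x) ⟩
    1# + 0#          ≈⟨ solve 1 (λ p → :1 :+ :0 := p :* :0 :+ :1) refl pᴮ ⟩
    pᴮ * 0# + 1#     ∎)
  ⟦map⟧≈xⁿ-mod-pᴮ (suc n) (a ∷ f) (length-f , leading≈1) lower∈m x = φ w + x * y , (begin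
    φ a + x * ⟦ map φ f ⟧ x        ≈⟨ +-cong (φ-pᴬ* a≈pᴬw) (*-congˡ f[x]≈pᴮy+xⁿ) ⟩
    pᴮ * φ w + x * (pᴮ * y + x ^ n)
      ≈⟨ solve 5 (λ p w x y X → p :* w :+ x :* (p :* y :+ X) := p :* (w :+ x :* y) :+ x :* X) refl pᴮ (φ w) x y (x ^ n) ⟩
    pᴮ * (φ w + x * y) + x ^ suc n ∎)
    where
    pᴬ∣a = proj₂ pᴬ-uniformizer a (lower∈m 0 (ℕ.s≤s ℕ.z≤n))
    w = proj₁ pᴬ∣a
    a≈pᴬw = proj₂ pᴬ∣a
    IH = ⟦map⟧≈xⁿ-mod-pᴮ n f (ℕ.suc-injective length-f , leading≈1) (λ i i<n → lower∈m (suc i) (ℕ.s≤s i<n)) x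
    y = proj₁ IH
    f[x]≈pᴮy+xⁿ = proj₂ IH

module EisensteinRoot {a ℓa b ℓb} (q : ℕ) (p-prime : Prime (suc (suc q)))
  (A : CommutativeRing a ℓa) (B : CommutativeRing b ℓb)
  (unramified : IsUnramifiedDVR A (suc (suc q)))
  (valuationRingB : IsValuationRing B) (henselianB : IsHenselian B)
  (φ : CommutativeRing.Carrier A → CommutativeRing.Carrier B) (extension : IsExtension A B φ)
  (e₂ : ℕ) (a₀ : CommutativeRing.Carrier A) (tl : List (CommutativeRing.Carrier A))
  (eisenstein : IsEisenstein A (a₀ ∷ tl) (suc (suc e₂))) where
  private
    module A  = CommutativeRing A
    module Aᵖ = Powers A
  open CommutativeRing B
  open SetoidReasoning setoid
  open NatCast B
  open IntegerSolver B
  open Powers B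
  open Units B
  open ValuationRing B valuationRingB
  open Polynomials B
  open UnramifiedDVR A q unramified using (pᴬ; pᴬ∈m; uniformizer≈pᴬ*unit; pᴬ^-divides-or-≈unit*pᴬ^)
  open Extension A B φ extension
  open ReductionModP q A B unramified φ extension
  open PAdicValuation q using (p; vp-factorisation)
  open OrderArithmetic
  open Newton B valuationRingB henselianB

  f : Poly A
  f = a₀ ∷ tl

  e₁ e v d : ℕ
  e₁ = suc e₂
  e  = suc e₁
  v  = vp p e
  d  = dBound p e

  tl-monic : IsMonicOfDegree A tl e₁
  tl-monic = ℕ.suc-injective (proj₁ (proj₁ eisenstein)) , proj₂ (proj₁ eisenstein)

  a₀≈pᴬ*unit : ∃ λ w → Unit A w × a₀ A.≈ pᴬ A.* w
  a₀≈pᴬ*unit = uniformizer≈pᴬ*unit (proj₂ (proj₂ eisenstein))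

  pᴮ∈m : InMaxIdeal B pᴮ
  pᴮ∈m = InMaxIdeal-resp-≈ φ-pᴬ (φ-InMaxIdeal pᴬ∈m)

  module _ (x z : Carrier) (f[x]≈pᵈz : ⟦ map φ f ⟧ x ≈ pᴮ ^ d * z) where

    tl[x]≈pᴮy+xᵉ¹ : ∃ λ y → ⟦ map φ tl ⟧ x ≈ pᴮ * y + x ^ e₁
    tl[x]≈pᴮy+xᵉ¹ = ⟦map⟧≈xⁿ-mod-pᴮ e₁ tl tl-monic (λ i i<e₁ → proj₁ (proj₂ eisenstein) (suc i) (ℕ.s≤s i<e₁)) x

    y : Carrier
    y = proj₁ tl[x]≈pᴮy+xᵉ¹

    u₀ : Carrier
    u₀ = φ (proj₁ a₀≈pᴬ*unit)

    -- pᴮ ^ d ≡ pᴮ * pᴮ ^ d₁ definitionally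
    d₁ : ℕ
    d₁ = v ℕ.+ e₁ ℕ.* suc v

    β : Carrier
    β = pᴮ ^ d₁ * z + - (u₀ + x * y)

    f[x]≈ : ⟦ map φ f ⟧ x ≈ pᴮ * u₀ + x * (pᴮ * y + x ^ e₁)
    f[x]≈ = +-cong (φ-pᴬ* (proj₂ (proj₂ a₀≈pᴬ*unit))) (*-congˡ (proj₂ tl[x]≈pᴮy+xᵉ¹))

    xᵉ≈pᴮβ : x ^ e ≈ pᴮ * β
    xᵉ≈pᴮβ = begin
      x * x ^ e₁                                         ≈⟨ solve 5 (λ X p u x y → x :* X := (p :* u :+ x :* (p :* y :+ X)) :- p :* (u :+ x :* y))
                                                                    refl (x ^ e₁) pᴮ u₀ x y ⟩
      (pᴮ * u₀ + x * (pᴮ * y + x ^ e₁)) + - (pᴮ * (u₀ + x * y)) ≈⟨ +-congʳ (trans (sym f[x]≈) f[x]≈pᵈz) ⟩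
      (pᴮ * pᴮ ^ d₁) * z + - (pᴮ * (u₀ + x * y))         ≈⟨ solve 5 (λ p P z u X → (p :* P) :* z :- p :* (u :+ X) := p :* (P :* z :- (u :+ X)))
                                                                    refl pᴮ (pᴮ ^ d₁) z u₀ (x * y) ⟩
      pᴮ * β                                             ∎

    pᴮ^d₁∈m : InMaxIdeal B (pᴮ ^ d₁)
    pᴮ^d₁∈m = InMaxIdeal-resp-≈ (reflexive (≡.cong (pᴮ ^_) (≡.sym (ℕ.+-suc v (v ℕ.+ e₂ ℕ.* suc v)))))
                                (InMaxIdeal-^ (v ℕ.+ (v ℕ.+ e₂ ℕ.* suc v)) pᴮ∈m)

    x∈m : InMaxIdeal B x
    x∈m x-unit = pᴮ∈m (Unit-*⇒Unitˡ (Unit-resp-≈ xᵉ≈pᴮβ (Unit-^ e x-unit)))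

    β-unit : Unit B β
    β-unit = InMaxIdeal-+-Unit (InMaxIdeal-*ʳ z pᴮ^d₁∈m)
                               (Unit-neg (Unit-+-InMaxIdeal (φ-Unit (proj₁ (proj₂ a₀≈pᴬ*unit))) (InMaxIdeal-*ʳ y x∈m)))

    ι : Carrier
    ι = proj₁ β-unit

    ι-unit : Unit B ι
    ι-unit = β , trans (*-comm ι β) (proj₂ β-unit)

    pᴮ≈xᵉι : pᴮ ≈ x ^ e * ι
    pᴮ≈xᵉι = begin
      pᴮ               ≈⟨ *-identityʳ pᴮ ⟨
      pᴮ * 1#          ≈⟨ *-congˡ (proj₂ β-unit) ⟨
      pᴮ * (β * ι)     ≈⟨ *-assoc pᴮ β ι ⟨
      (pᴮ * β) * ι     ≈⟨ *-congʳ xᵉ≈pᴮβ ⟨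
      x ^ e * ι        ∎

    pᴮ^≈x^*ι^ : ∀ n → pᴮ ^ n ≈ x ^ (e ℕ.* n) * ι ^ n
    pᴮ^≈x^*ι^ n = begin
      pᴮ ^ n                   ≈⟨ ^-congˡ n pᴮ≈xᵉι ⟩
      (x ^ e * ι) ^ n          ≈⟨ ^-distrib-* _ ι n ⟩
      (x ^ e) ^ n * ι ^ n      ≈⟨ *-congʳ (^-assocʳ x e n) ⟩
      x ^ (e ℕ.* n) * ι ^ n    ∎

    open XAdicOrder B valuationRingB x

    φ-HasOrder : ∀ {a u} n → Unit A u → a A.≈ u A.* pᴬ Aᵖ.^ n → HasOrder (φ a) (e ℕ.* n)
    φ-HasOrder {a} {u} n u-unit a≈upⁿ = hasOrder (ι ^ n * φ u) (Unit-* (Unit-^ n ι-unit) (φ-Unit u-unit)) (begin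
      φ a                               ≈⟨ trans (φ-cong a≈upⁿ) (φ-* u _) ⟩
      φ u * φ (pᴬ Aᵖ.^ n)               ≈⟨ *-congˡ (trans (φ-^ pᴬ n) (^-congˡ n φ-pᴬ)) ⟩
      φ u * pᴮ ^ n                      ≈⟨ *-congˡ (pᴮ^≈x^*ι^ n) ⟩
      φ u * (x ^ (e ℕ.* n) * ι ^ n)     ≈⟨ solve 3 (λ u X I → u :* (X :* I) := X :* (I :* u)) refl (φ u) (x ^ (e ℕ.* n)) (ι ^ n) ⟩
      x ^ (e ℕ.* n) * (ι ^ n * φ u)     ∎)

    φ-pᴬ^-divides : ∀ {a} n → Divides A (pᴬ Aᵖ.^ n) a → Divides B (x ^ (e ℕ.* n)) (φ a)
    φ-pᴬ^-divides {a} n (w , a≈pⁿw) = ι ^ n * φ w , (begin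
      φ a                               ≈⟨ trans (φ-cong a≈pⁿw) (φ-* _ w) ⟩
      φ (pᴬ Aᵖ.^ n) * φ w               ≈⟨ *-congʳ (trans (φ-^ pᴬ n) (trans (^-congˡ n φ-pᴬ) (pᴮ^≈x^*ι^ n))) ⟩
      (x ^ (e ℕ.* n) * ι ^ n) * φ w     ≈⟨ *-assoc _ _ _ ⟩
      x ^ (e ℕ.* n) * (ι ^ n * φ w)     ∎)

    e-HasOrder : HasOrder (fromℕ e) (e ℕ.* v)
    e-HasOrder = hasOrder (ι ^ v * fromℕ m) (Unit-* (Unit-^ v ι-unit) (fromℕ-Unit p-prime pᴮ∈m p∤m)) (begin
      fromℕ e                             ≈⟨ reflexive (≡.cong fromℕ e≡pᵛm) ⟩
      fromℕ (p ℕ.^ v ℕ.* m)               ≈⟨ fromℕ-* (p ℕ.^ v) m ⟩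
      fromℕ (p ℕ.^ v) * fromℕ m           ≈⟨ *-congʳ (trans (fromℕ-^ p v) (pᴮ^≈x^*ι^ v)) ⟩
      (x ^ (e ℕ.* v) * ι ^ v) * fromℕ m   ≈⟨ *-assoc _ _ _ ⟩
      x ^ (e ℕ.* v) * (ι ^ v * fromℕ m)   ∎)
      where
      e=pᵛm = vp-factorisation e₁
      m     = proj₁ e=pᵛm
      e≡pᵛm = proj₁ (proj₂ e=pᵛm)
      p∤m   = proj₂ (proj₂ e=pᵛm)

    -- S stands for Σᵢ≥ₛ (i + 1) aᵢ₊₁ xⁱ⁻ˢ; `index` is the i whose term (i + 1) aᵢ₊₁ xⁱ of xˢ S
    -- has least order, unique since these orders are e·n + i or exceed e v + e − 1.
    record TailOrder (s : ℕ) (S : Carrier) : Set (b Level.⊔ ℓb) where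
      constructor tailOrder
      field
        order quotient index : ℕ
        orderOf-S   : HasOrder S order
        s≤index     : s ℕ.≤ index
        index<e     : index ℕ.< e
        order+s≡    : order ℕ.+ s ≡ e ℕ.* quotient ℕ.+ index
        order+s≤    : order ℕ.+ s ℕ.≤ e ℕ.* v ℕ.+ e₁

    TailOrder-∷ : ∀ {s} a {S′} → s ℕ.≤ e₁ → TailOrder (suc s) S′ →
                  TailOrder s (natMul B (suc s) (φ a) + x * S′)
    TailOrder-∷ {s} a {S′} s≤e₁ (tailOrder K n j S′-order s<j j<e K+s≡ K+s≤) =
      by-classification (pᴬ^-divides-or-≈unit*pᴬ^ (suc (suc v)) c)
      where
      c = natMul A (suc s) a
      φc≈ : φ c ≈ natMul B (suc s) (φ a)
      φc≈ = φ-natMul (suc s) a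
      sK≡ : suc K ℕ.+ s ≡ K ℕ.+ suc s
      sK≡ = ≡.sym (ℕ.+-suc K s)
      K+1+s≤ : suc K ℕ.+ s ℕ.≤ e ℕ.* v ℕ.+ e₁
      K+1+s≤ = ≡.subst (ℕ._≤ e ℕ.* v ℕ.+ e₁) (≡.sym sK≡) K+s≤
      xS′-order : HasOrder (x * S′) (suc K)
      xS′-order = HasOrder-x* S′-order

      tail-dominates : OrderAbove (natMul B (suc s) (φ a)) (suc K) → TailOrder s _
      tail-dominates c>K = tailOrder (suc K) n j (OrderAbove-+-HasOrder x∈m c>K xS′-order) (ℕ.<⇒≤ s<j) j<e
                                     (≡.trans sK≡ K+s≡) K+1+s≤

      by-comparison : ∀ {n′} → HasOrder (natMul B (suc s) (φ a)) (e ℕ.* n′) →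
                      Tri (e ℕ.* n′ ℕ.< suc K) (e ℕ.* n′ ≡ suc K) (suc K ℕ.< e ℕ.* n′) → TailOrder s _
      by-comparison {n′} c-order (tri< en′<K+1 _ _) =
        tailOrder (e ℕ.* n′) n′ s (HasOrder-+-OrderAbove x∈m c-order (HasOrder⇒OrderAbove xS′-order en′<K+1))
                  ℕ.≤-refl (ℕ.s≤s s≤e₁) ≡.refl (ℕ.≤-trans (ℕ.<⇒≤ (ℕ.+-monoˡ-< s en′<K+1)) K+1+s≤)
      by-comparison {n′} c-order (tri≈ _ en′≡K+1 _) =
        ⊥-elim (ℕ.<⇒≢ s<j (remainder-unique e n′ n s j (ℕ.s≤s s≤e₁) j<e
                                           (≡.trans (≡.cong (ℕ._+ s) en′≡K+1) (≡.trans sK≡ K+s≡))))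
      by-comparison c-order (tri> _ _ K+1<en′) = tail-dominates (HasOrder⇒OrderAbove c-order K+1<en′)

      by-classification : Divides A (pᴬ Aᵖ.^ suc (suc v)) c ⊎ (∃ λ n′ → ∃ λ u → Unit A u × c A.≈ u A.* pᴬ Aᵖ.^ n′) →
                          TailOrder s _
      by-classification (inj₁ pᵛ⁺²∣c) = tail-dominates (x^-divides⇒OrderAbove
        (proj₁ φpᵛ⁺²∣c , trans (sym φc≈) (proj₂ φpᵛ⁺²∣c)) (<e*[2+v] e₁ v K s K+s≤))
        where φpᵛ⁺²∣c = φ-pᴬ^-divides (suc (suc v)) pᵛ⁺²∣c
      by-classification (inj₂ (n′ , u , u-unit , c≈upⁿ′)) =
        by-comparison {n′} (HasOrder-resp-≈ φc≈ (φ-HasOrder n′ u-unit c≈upⁿ′)) (ℕ.<-cmp (e ℕ.* n′) (suc K))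

    ⟦derivAux⟧-order : ∀ m s L → IsMonicOfDegree A L m → s ℕ.+ m ≡ e₁ →
                        TailOrder s (⟦ derivAux B (suc s) (map φ L) ⟧ x)
    ⟦derivAux⟧-order zero s (a ∷ []) (_ , a≈1) s+0≡e₁ =
      tailOrder (e ℕ.* v) v s (HasOrder-resp-≈ (sym S≈e) e-HasOrder) ℕ.≤-refl (ℕ.s≤s s≤e₁) ≡.refl
                (ℕ.+-monoʳ-≤ (e ℕ.* v) s≤e₁)
      where
      s≡e₁ : s ≡ e₁
      s≡e₁ = ≡.trans (≡.sym (ℕ.+-identityʳ s)) s+0≡e₁
      s≤e₁ : s ℕ.≤ e₁
      s≤e₁ = ℕ.≤-reflexive s≡e₁
      S≈e : natMul B (suc s) (φ a) + x * 0# ≈ fromℕ e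
      S≈e = begin
        natMul B (suc s) (φ a) + x * 0#   ≈⟨ +-cong (natMul≈fromℕ* (suc s) (φ a)) (zeroʳ x) ⟩
        fromℕ (suc s) * φ a + 0#          ≈⟨ +-identityʳ _ ⟩
        fromℕ (suc s) * φ a               ≈⟨ *-congˡ (trans (φ-cong a≈1) φ-1#) ⟩
        fromℕ (suc s) * 1#                ≈⟨ *-identityʳ _ ⟩
        fromℕ (suc s)                     ≈⟨ reflexive (≡.cong (λ k → fromℕ (suc k)) s≡e₁) ⟩
        fromℕ e                           ∎
    ⟦derivAux⟧-order (suc m) s (a ∷ L) (length-L , leading≈1) s+m≡e₁ =
      TailOrder-∷ a (≡.subst (s ℕ.≤_) s+m≡e₁ (ℕ.m≤m+n s (suc m)))
        (⟦derivAux⟧-order m (suc s) L (ℕ.suc-injective length-L , leading≈1) (≡.trans (≡.sym (ℕ.+-suc s m)) s+m≡e₁))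

    D : Carrier
    D = ⟦ map φ f ′ ⟧ x

    D-tailOrder : TailOrder 0 D
    D-tailOrder = ⟦derivAux⟧-order e₁ 0 tl tl-monic ≡.refl

    K : ℕ
    K = TailOrder.order D-tailOrder

    -- f(x) = pᵈ z has order e d > 2 K, which leaves the factor c ∈ 𝔪 over f′(x)².
    f[x]≈D²*c : ∃ λ c → InMaxIdeal B c × ⟦ map φ f ⟧ x ≈ (D * D) * c
    f[x]≈D²*c =
      x ^ suc t * (ι ^ d * z) * (u′ * u′) , InMaxIdeal-*ʳ _ (InMaxIdeal-*ʳ _ (InMaxIdeal-^ t x∈m)) , sym (begin
      (D * D) * (xᵗ⁺¹ * (ι ^ d * z) * (u′ * u′))
        ≈⟨ *-congʳ (*-cong D≈xᴷu D≈xᴷu) ⟩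
      (x ^ K * u) * (x ^ K * u) * (xᵗ⁺¹ * (ι ^ d * z) * (u′ * u′))
        ≈⟨ solve 6 (λ X u T Z u′ w → (X :* u) :* (X :* u) :* (T :* Z :* (u′ :* u′))
                                    := ((X :* X) :* T) :* Z :* ((u :* u′) :* (u :* u′))) refl (x ^ K) u xᵗ⁺¹ (ι ^ d * z) u′ u′ ⟩
      ((x ^ K * x ^ K) * xᵗ⁺¹) * (ι ^ d * z) * ((u * u′) * (u * u′))
        ≈⟨ *-congˡ (trans (*-cong uu′≈1 uu′≈1) (*-identityʳ 1#)) ⟩
      ((x ^ K * x ^ K) * xᵗ⁺¹) * (ι ^ d * z) * 1#
        ≈⟨ *-identityʳ _ ⟩
      ((x ^ K * x ^ K) * xᵗ⁺¹) * (ι ^ d * z)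
        ≈⟨ *-congʳ (trans (^-homo-* x (K ℕ.+ K) (suc t)) (*-congʳ (^-homo-* x K K))) ⟨
      x ^ ((K ℕ.+ K) ℕ.+ suc t) * (ι ^ d * z)
        ≡⟨ ≡.cong (λ k → x ^ k * (ι ^ d * z)) 2K+t+1≡ed ⟩
      x ^ (e ℕ.* d) * (ι ^ d * z)
        ≈⟨ *-assoc _ _ _ ⟨
      (x ^ (e ℕ.* d) * ι ^ d) * z
        ≈⟨ *-congʳ (pᴮ^≈x^*ι^ d) ⟨
      pᴮ ^ d * z
        ≈⟨ f[x]≈pᵈz ⟨
      ⟦ map φ f ⟧ x ∎)
      where
      open HasOrder (TailOrder.orderOf-S D-tailOrder) renaming (unit to u; factorise to D≈xᴷu)
      u′    = proj₁ isUnit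
      uu′≈1 = proj₂ isUnit
      K≤ : K ℕ.≤ e ℕ.* v ℕ.+ e₁
      K≤ = ≡.subst (ℕ._≤ e ℕ.* v ℕ.+ e₁) (ℕ.+-identityʳ K) (TailOrder.order+s≤ D-tailOrder)
      t = e ℕ.* d ℕ.∸ suc (K ℕ.+ K)
      xᵗ⁺¹ = x ^ suc t
      2K+t+1≡ed : (K ℕ.+ K) ℕ.+ suc t ≡ e ℕ.* d
      2K+t+1≡ed = ≡.trans (ℕ.+-suc (K ℕ.+ K) t) (ℕ.m+[n∸m]≡n (2K<e*d e₂ v K K≤))

    root : ∃ λ r → ⟦ map φ f ⟧ r ≈ 0#
    root = newton (map φ f) e₁ (map-monic {f} (proj₁ eisenstein)) x (proj₁ f[x]≈D²*c)
                  (proj₂ (proj₂ f[x]≈D²*c)) (proj₁ (proj₂ f[x]≈D²*c))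

prime⇒≡2+ : ∀ {p} → Prime p → ∃ λ q → p ≡ suc (suc q)
prime⇒≡2+ {p} p-prime with ℕ.nonTrivial⇒n>1 p {{prime⇒nonTrivial p-prime}}
  where open import Data.Nat.Primality using (prime⇒nonTrivial)
... | ℕ.s≤s (ℕ.s≤s {n = q} _) = q , ≡.refl

divisible⇒root : {a ℓa b ℓb : Level} (q : ℕ) → Prime (suc (suc q)) →
  (A : CommutativeRing a ℓa) (B : CommutativeRing b ℓb) →
  IsUnramifiedDVR A (suc (suc q)) → IsValuationRing B → IsHenselian B →
  (φ : CommutativeRing.Carrier A → CommutativeRing.Carrier B) → IsExtension A B φ →
  (f : Poly A) (e : ℕ) → IsEisenstein A f e →
  (∃ λ x → Divides B (_^ᴿ_ B (natMul B (suc (suc q)) (CommutativeRing.1# B)) (dBound (suc (suc q)) e)) (eval B (map φ f) x)) →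
  ∃ λ x → CommutativeRing._≈_ B (eval B (map φ f) x) (CommutativeRing.0# B)
divisible⇒root q p-prime A B unramified valuationRingB henselianB φ extension f zero
               ((_ , f₀≈1) , _ , f₀∈m , _) _ =
  ⊥-elim (f₀∈m (Units.Unit-resp-≈ A (CommutativeRing.sym A f₀≈1) (Units.Unit-1# A)))
divisible⇒root q p-prime A B unramified valuationRingB henselianB φ extension f 1 (monic , _) _ =
  Polynomials.monicLinear-root B (map φ f) (Extension.map-monic A B φ extension {f} monic)
divisible⇒root q p-prime A B unramified valuationRingB henselianB φ extension [] (suc (suc e₂)) ((() , _) , _) _
divisible⇒root q p-prime A B unramified valuationRingB henselianB φ extension (a₀ ∷ tl) (suc (suc e₂))
               eisenstein (x , z , f[x]≈pᵈz) =
  EisensteinRoot.root q p-prime A B unramified valuationRingB henselianB φ extension e₂ a₀ tl eisenstein x z f[x]≈pᵈz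

proposition3p3 : {a ℓa b ℓb : Level} (p : ℕ) → Prime p →
    (A : CommutativeRing a ℓa) (B : CommutativeRing b ℓb) →
    IsUnramifiedDVR A p →
    IsValuationRing B → IsHenselian B →
    (φ : CommutativeRing.Carrier A → CommutativeRing.Carrier B) → IsExtension A B φ →
    (f : Poly A) (e : ℕ) → IsEisenstein A f e →
    (∃ λ x → CommutativeRing._≈_ B (eval B (map φ f) x) (CommutativeRing.0# B))
    ⇔
    (∃ λ x → Divides B (_^ᴿ_ B (natMul B p (CommutativeRing.1# B)) (dBound p e)) (eval B (map φ f) x))
proposition3p3 p p-prime A B unramified valuationRingB henselianB φ extension f e eisenstein
  with prime⇒≡2+ p-prime
... | q , ≡.refl =
  mk⇔ (λ (x , f[x]≈0) → x , 0# , trans f[x]≈0 (sym (zeroʳ _)))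
      (divisible⇒root q p-prime A B unramified valuationRingB henselianB φ extension f e eisenstein)
  where open CommutativeRing B
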